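{- Let $n\ge 0$, $k\in\mathbb{Z}$, $s\in\mathbb{Z}_{\ge0}$ and $a\in\mathbb{C}$ with $a\neq0$. Then \[ PC_{n}^{(k)}(x:a)=\sum_{m=0}^{n}\left\{(-1)^{m}\sum_{l=0}^{n-m}\sum_{i=0}^{l}\frac{\binom{n}{l}\binom{l}{i}}{a^{n-l+i}}S_{1}(n-l,m)\,\mathbb{C}_{i}^{(s)}\,PC_{l-i}^{(k)}(s:a)\right\}B_{m}^{(s)}(x). \]
   Context: For an integer $k$, $\mathrm{Lif}_k(t)=\sum_{n=0}^{\infty}\frac{t^{n}}{n!\,(n+1)^{k}}$. For $a\neq0$, $PC_n^{(k)}(x:a)$ is defined by $e^{ -t}\,\mathrm{Lif}_k\!\left(\log\left(1+\frac{t}{a}\right)\right)\left(1+\frac{t}{a}\right)^{ -x}=\sum_{n\ge0}PC_n^{(k)}(x:a)\frac{t^n}{n!}$. $S_1(n,l)$ denotes the (signed) Stirling numbers of the first kind, defined by $x(x-1)\cdots(x-n+1)=\sum_{l=0}^{n}S_1(n,l)x^l$. The Cauchy numbers of the first kind of order $s$ are defined by $\left(\frac{t}{\log(1+t)}\right)^{s}=\sum_{n\ge0}\mathbb{C}_n^{(s)}\frac{t^n}{n!}$. The Bernoulli polynomials of order $s$ are defined by $\left(\frac{t}{e^t-1}\right)^{s}e^{xt}=\sum_{n\ge0}B_n^{(s)}(x)\frac{t^n}{n!}$. -}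

module Defs where

open import Level using (Level; _⊔_)
open import Algebra.Bundles using (CommutativeRing)
open import Data.Nat as ℕ using (ℕ; zero; suc; _∸_; _!)
open import Data.Nat.Combinatorics using (_C_)
open import Data.Integer as ℤ using (ℤ; +_; -[1+_])
open import Relation.Nullary using (¬_)

embedℕ : ∀ {c ℓ} (R : CommutativeRing c ℓ) → ℕ → CommutativeRing.Carrier R
embedℕ R zero    = CommutativeRing.0# R
embedℕ R (suc n) = CommutativeRing._+_ R (CommutativeRing.1# R) (embedℕ R n)

-- A field of characteristic zero (stands in for ℂ).
-- Inversion is a total operation whose value at 0 is irrelevant.
record CharZeroField (c ℓ : Level) : Set (Level.suc (c ⊔ ℓ)) where
  field
    ring     : CommutativeRing c ℓ
    _⁻¹      : CommutativeRing.Carrier ring → CommutativeRing.Carrier ring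
    inverseʳ : ∀ x → ¬ (CommutativeRing._≈_ ring x (CommutativeRing.0# ring))
               → CommutativeRing._≈_ ring (CommutativeRing._*_ ring x (x ⁻¹)) (CommutativeRing.1# ring)
    char0    : ∀ n → ¬ (CommutativeRing._≈_ ring (embedℕ ring (suc n)) (CommutativeRing.0# ring))
  infix 8 _⁻¹
  open CommutativeRing ring public hiding (ring)

  ι : ℕ → Carrier
  ι = embedℕ ring

module Series {c ℓ} (F : CharZeroField c ℓ) where
  open CharZeroField F

  ιℤ : ℤ → Carrier
  ιℤ (+ n)    = ι n
  ιℤ -[1+ n ] = - ι (suc n)

  _^_ : Carrier → ℕ → Carrier
  x ^ zero  = 1#
  x ^ suc n = x * (x ^ n)

  _^ℤ_ : Carrier → ℤ → Carrier
  x ^ℤ (+ n)    = x ^ n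
  x ^ℤ -[1+ n ] = (x ⁻¹) ^ suc n

  Σ≤ : ℕ → (ℕ → Carrier) → Carrier
  Σ≤ zero    f = f 0
  Σ≤ (suc n) f = Σ≤ n f + f (suc n)

  FPS : Set c
  FPS = ℕ → Carrier

  _⋆_ : FPS → FPS → FPS
  (f ⋆ g) n = Σ≤ n (λ i → f i * g (n ∸ i))

  one : FPS
  one zero    = 1#
  one (suc _) = 0#

  _^ₛ_ : FPS → ℕ → FPS
  f ^ₛ zero  = one
  f ^ₛ suc j = f ⋆ (f ^ₛ j)

  -- composition f(g(t)), meaningful when g 0 ≈ 0
  _∘ₛ_ : FPS → FPS → FPS
  (f ∘ₛ g) n = Σ≤ n (λ j → f j * (g ^ₛ j) n)

  scale : Carrier → FPS → FPS
  scale c f n = c * f n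

  tₛ : FPS
  tₛ 1 = 1#
  tₛ _ = 0#

  _-ₛ_ : FPS → FPS → FPS
  (f -ₛ g) n = f n - g n

  expₛ : FPS
  expₛ n = (ι (n !)) ⁻¹

  log1pₛ : FPS
  log1pₛ zero    = 0#
  log1pₛ (suc n) = ((- 1#) ^ n) * (ι (suc n)) ⁻¹

  geomₛ : FPS
  geomₛ _ = 1#

  -- reciprocal of a series h with h 0 = 1:  1/h = 1/(1-(1-h))
  recipₛ : FPS → FPS
  recipₛ h = geomₛ ∘ₛ (one -ₛ h)

  Lifₛ : ℤ → FPS
  Lifₛ k n = (ι (n !) * (ι (suc n) ^ℤ k)) ⁻¹

  logA : Carrier → FPS
  logA a = log1pₛ ∘ₛ scale (a ⁻¹) tₛ

  -- e^{-t} Lif_k(log(1+t/a)) (1+t/a)^{-x},  with (1+t/a)^{-x} = exp(-x log(1+t/a))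
  PCgen : ℤ → Carrier → Carrier → FPS
  PCgen k x a = (expₛ ∘ₛ scale (- 1#) tₛ)
              ⋆ ((Lifₛ k ∘ₛ logA a) ⋆ (expₛ ∘ₛ scale (- x) (logA a)))

  PC : ℕ → ℤ → Carrier → Carrier → Carrier
  PC n k x a = ι (n !) * PCgen k x a n

  -- (t / log(1+t))^s ;  log(1+t)/t = Σ (-1)^n tⁿ/(n+1)
  logQuot : FPS
  logQuot n = ((- 1#) ^ n) * (ι (suc n)) ⁻¹

  Cauchy : ℕ → ℕ → Carrier
  Cauchy s n = ι (n !) * (recipₛ logQuot ^ₛ s) n

  -- (e^t - 1)/t = Σ tⁿ/(n+1)!
  expQuot : FPS
  expQuot n = (ι (suc n !)) ⁻¹

  -- Bernoulli polynomials of order s:  (t/(e^t-1))^s e^{xt}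
  Bernoulli : ℕ → ℕ → Carrier → Carrier
  Bernoulli s n x = ι (n !) * ((recipₛ expQuot ^ₛ s) ⋆ (expₛ ∘ₛ scale x tₛ)) n

-- signed Stirling numbers of the first kind, as the coefficients of the
-- falling factorial x(x-1)...(x-n+1), coefficient lists ℕ → ℤ
-- multiply a polynomial p by (x - c)
mulLin : ℤ → (ℕ → ℤ) → (ℕ → ℤ)
mulLin c p zero    = ℤ.- (c ℤ.* p 0)
mulLin c p (suc l) = p l ℤ.- (c ℤ.* p (suc l))

fallingFactorial : ℕ → (ℕ → ℤ)
fallingFactorial zero zero    = + 1
fallingFactorial zero (suc _) = + 0
fallingFactorial (suc n) = mulLin (+ n) (fallingFactorial n)

S₁ : ℕ → ℕ → ℤ
S₁ n l = fallingFactorial n l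

module Submission where

-- Put u = t/a, L = log(1+u), N = -L (so e^N = (1+u)^{-1}), and let
-- R = t/(e^t-1), K = t/log(1+t).  Let G_y = e^{-t} Lif_k(L) (1+u)^{-y} be the
-- generating function of PC_n^{(k)}(y:a).  Since e^N - 1 = -u(1+u)^{-1}, we get
-- (e^N-1)/N · log(1+u)/u = (1+u)^{-1}, i.e.  R(N) · K(u) · (1+u)^{-1} = 1.
-- Hence (1+u)^{-x} = e^{xN} · (R(N) K(u))^s · (1+u)^{-s}, and so
--     G_x = (R^s e^{xt})(N) · H,        H = K(u)^s · G_s.
-- Taking the coefficient of t^n: the n-th coefficient of f(N)·H is
-- Σ_m f_m (N^m H)_n, the coefficients of R^s e^{xt} are B_m^{(s)}(x)/m!, those
-- of K(u)^s are C_i^{(s)}/(i! a^i), and N^m = (-1)^m L^m where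
-- L^m = m! Σ_j S_1(j,m) t^j/(j! a^j).

open import Defs
open import Data.Nat as ℕ using (ℕ; zero; suc; _∸_; _!; z≤n; s≤s)
import Data.Nat.Properties as NP
open import Data.Nat.Properties using (_!*_!≢0)
open import Data.Nat.Combinatorics using (_C_; nCk≡n!/k![n-k]!; k![n∸k]!∣n!)
open import Data.Nat.DivMod using (m/n*n≡m)
open import Data.Integer as ℤ using (ℤ; +_; -[1+_]; _⊖_)
import Data.Integer.Properties as ZP
open import Relation.Nullary using (¬_)
open import Relation.Binary.PropositionalEquality as P using (_≡_)
open import Data.Product using (_,_)
open import Data.Sum using (inj₁; inj₂)
open import Data.Empty using (⊥-elim)
open import Algebra.Bundles using (CommutativeMonoid; CommutativeRing)
import Algebra.Properties.Ring as RingProperties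
import Algebra.Properties.AbelianGroup as AbelianGroupProperties
import Algebra.Solver.CommutativeMonoid as CommutativeMonoidSolver
import Algebra.Properties.CommutativeSemigroup as CommutativeSemigroupProperties
import Relation.Binary.Reasoning.Setoid as SetoidReasoning

binomial-factorials : ∀ {n k} → k ℕ.≤ n → (n C k) ℕ.* (k ! ℕ.* (n ∸ k) !) ≡ n !
binomial-factorials {n} {k} le =
  P.trans (P.cong (ℕ._* (k ! ℕ.* (n ∸ k) !)) (nCk≡n!/k![n-k]! le))
          (m/n*n≡m {{k !* (n ∸ k) !≢0}} (k![n∸k]!∣n! le))

∸-swap-< : ∀ n m l → l ℕ.≤ n → n ∸ m ℕ.< l → n ∸ l ℕ.< m
∸-swap-< n zero l le lt = ⊥-elim (NP.<⇒≱ lt le)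
∸-swap-< n (suc m) l le lt =
  NP.m<n+o⇒m∸n<o n l (NP.≤-<-trans (NP.m≤n+m∸n n (suc m))
    (P.subst (suc m ℕ.+ (n ∸ suc m) ℕ.<_) (NP.+-comm (suc m) l) (NP.+-monoʳ-< (suc m) lt)))

module FieldArithmetic {c ℓ} (F : CharZeroField c ℓ) where
  open CharZeroField F
  open Series F

  open import Algebra.Solver.Ring.NaturalCoefficients.Default commutativeSemiring public
    using (solve; _:=_; _:+_; _:*_)
  open SetoidReasoning setoid public
  private
    module RP = RingProperties (CommutativeRing.ring ring)
    module AG = AbelianGroupProperties +-abelianGroup

  ι-+ : ∀ m n → ι (m ℕ.+ n) ≈ ι m + ι n
  ι-+ zero n = sym (+-identityˡ _)
  ι-+ (suc m) n = trans (+-congˡ (ι-+ m n)) (sym (+-assoc _ _ _))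

  ι-* : ∀ m n → ι (m ℕ.* n) ≈ ι m * ι n
  ι-* zero n = sym (zeroˡ _)
  ι-* (suc m) n = begin
    ι (n ℕ.+ m ℕ.* n)    ≈⟨ ι-+ n (m ℕ.* n) ⟩
    ι n + ι (m ℕ.* n)    ≈⟨ +-congˡ (ι-* m n) ⟩
    ι n + ι m * ι n      ≈⟨ +-congʳ (sym (*-identityˡ _)) ⟩
    1# * ι n + ι m * ι n ≈⟨ sym (distribʳ _ _ _) ⟩
    (1# + ι m) * ι n     ∎

  ι1 : ι 1 ≈ 1#
  ι1 = +-identityʳ 1#

  invˡ : ∀ {x} → ¬ (x ≈ 0#) → x ⁻¹ * x ≈ 1#
  invˡ {x} nz = trans (*-comm _ _) (inverseʳ x nz)

  cancelˡ : ∀ {x y z} → ¬ (x ≈ 0#) → x * y ≈ x * z → y ≈ z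
  cancelˡ {x} {y} {z} nz eq = begin
    y                ≈⟨ sym (*-identityˡ y) ⟩
    1# * y           ≈⟨ *-congʳ (sym (invˡ nz)) ⟩
    (x ⁻¹ * x) * y   ≈⟨ *-assoc _ _ _ ⟩
    x ⁻¹ * (x * y)   ≈⟨ *-congˡ eq ⟩
    x ⁻¹ * (x * z)   ≈⟨ sym (*-assoc _ _ _) ⟩
    (x ⁻¹ * x) * z   ≈⟨ *-congʳ (invˡ nz) ⟩
    1# * z           ≈⟨ *-identityˡ z ⟩
    z                ∎

  *-≉0 : ∀ {x y} → ¬ (x ≈ 0#) → ¬ (y ≈ 0#) → ¬ (x * y ≈ 0#)
  *-≉0 {x} nx ny eq = ny (cancelˡ nx (trans eq (sym (zeroʳ x))))

  inv-unique : ∀ {x y} → ¬ (x ≈ 0#) → x * y ≈ 1# → x ⁻¹ ≈ y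
  inv-unique nz eq = cancelˡ nz (trans (inverseʳ _ nz) (sym eq))

  inv-cong : ∀ {x y} → ¬ (x ≈ 0#) → x ≈ y → x ⁻¹ ≈ y ⁻¹
  inv-cong nz eq = inv-unique nz (trans (*-congʳ eq) (inverseʳ _ (λ y0 → nz (trans eq y0))))

  inv-* : ∀ {x y} → ¬ (x ≈ 0#) → ¬ (y ≈ 0#) → (x * y) ⁻¹ ≈ x ⁻¹ * y ⁻¹
  inv-* {x} {y} nx ny = inv-unique (*-≉0 nx ny) (begin
    (x * y) * (x ⁻¹ * y ⁻¹)
      ≈⟨ solve 4 (λ a b c d → ((a :* b) :* (c :* d)) := ((a :* c) :* (b :* d))) refl x y (x ⁻¹) (y ⁻¹) ⟩
    (x * x ⁻¹) * (y * y ⁻¹) ≈⟨ *-cong (inverseʳ x nx) (inverseʳ y ny) ⟩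
    1# * 1#                 ≈⟨ *-identityˡ _ ⟩
    1#                      ∎)

  1≉0 : ¬ (1# ≈ 0#)
  1≉0 eq = char0 0 (trans ι1 eq)

  inv-1 : 1# ⁻¹ ≈ 1#
  inv-1 = inv-unique 1≉0 (*-identityˡ 1#)

  inv-≉0 : ∀ {x} → ¬ (x ≈ 0#) → ¬ (x ⁻¹ ≈ 0#)
  inv-≉0 {x} nz eq = 1≉0 (trans (sym (inverseʳ x nz)) (trans (*-congˡ eq) (zeroʳ x)))

  ι!≉0 : ∀ n → ¬ (ι (n !) ≈ 0#)
  ι!≉0 zero = char0 0
  ι!≉0 (suc n) eq = *-≉0 (char0 n) (ι!≉0 n) (trans (sym (ι-* (suc n) (n !))) eq)

  inv-suc! : ∀ n → (ι (suc n !)) ⁻¹ ≈ (ι (suc n)) ⁻¹ * (ι (n !)) ⁻¹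
  inv-suc! n = trans (inv-cong (ι!≉0 (suc n)) (ι-* (suc n) (n !))) (inv-* (char0 n) (ι!≉0 n))

  ι-suc-inv-suc! : ∀ n → ι (suc n) * (ι (suc n !)) ⁻¹ ≈ (ι (n !)) ⁻¹
  ι-suc-inv-suc! n = begin
    ι (suc n) * (ι (suc n !)) ⁻¹                 ≈⟨ *-congˡ (inv-suc! n) ⟩
    ι (suc n) * ((ι (suc n)) ⁻¹ * (ι (n !)) ⁻¹)  ≈⟨ sym (*-assoc _ _ _) ⟩
    (ι (suc n) * (ι (suc n)) ⁻¹) * (ι (n !)) ⁻¹  ≈⟨ *-congʳ (inverseʳ _ (char0 n)) ⟩
    1# * (ι (n !)) ⁻¹                            ≈⟨ *-identityˡ _ ⟩
    (ι (n !)) ⁻¹                                 ∎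

  pow-+ : ∀ x p q → x ^ (p ℕ.+ q) ≈ x ^ p * x ^ q
  pow-+ x zero q = sym (*-identityˡ _)
  pow-+ x (suc p) q = trans (*-congˡ (pow-+ x p q)) (sym (*-assoc _ _ _))

  pow-* : ∀ x y p → (x * y) ^ p ≈ x ^ p * y ^ p
  pow-* x y zero = sym (*-identityˡ _)
  pow-* x y (suc p) = trans (*-congˡ (pow-* x y p))
    (solve 4 (λ a b c d → ((a :* b) :* (c :* d)) := ((a :* c) :* (b :* d))) refl x y (x ^ p) (y ^ p))

  pow-cong : ∀ {x y} p → x ≈ y → x ^ p ≈ y ^ p
  pow-cong zero eq = refl
  pow-cong (suc p) eq = *-cong eq (pow-cong p eq)

  pow-≉0 : ∀ {x} p → ¬ (x ≈ 0#) → ¬ (x ^ p ≈ 0#)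
  pow-≉0 zero nz = 1≉0
  pow-≉0 (suc p) nz = *-≉0 nz (pow-≉0 p nz)

  inv-pow : ∀ {x} p → ¬ (x ≈ 0#) → (x ^ p) ⁻¹ ≈ (x ⁻¹) ^ p
  inv-pow zero nz = inv-1
  inv-pow (suc p) nz = trans (inv-* nz (pow-≉0 p nz)) (*-congˡ (inv-pow p nz))

  open RP public using (-1*x≈-x; -‿involutive; [y-z]x≈yx-zx)

  -‿+ : ∀ x y → - (x + y) ≈ - x + - y
  -‿+ x y = sym (AG.⁻¹-∙-comm x y)

  -0≈0 : - 0# ≈ 0#
  -0≈0 = AG.ε⁻¹≈ε

  -1#≉0 : ¬ (- 1# ≈ 0#)
  -1#≉0 eq = 1≉0 (trans (sym (-‿involutive 1#)) (trans (-‿cong eq) -0≈0))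

  x-0≈x : ∀ x → x - 0# ≈ x
  x-0≈x x = trans (+-congˡ -0≈0) (+-identityʳ x)

  move-right : ∀ {a b c} → a + b ≈ c → a ≈ c - b
  move-right {a} {b} {c} e = begin
    a             ≈⟨ sym (+-identityʳ a) ⟩
    a + 0#        ≈⟨ +-congˡ (sym (-‿inverseʳ b)) ⟩
    a + (b - b)   ≈⟨ sym (+-assoc _ _ _) ⟩
    (a + b) - b   ≈⟨ +-congʳ e ⟩
    c - b         ∎

  ιℤ-⊖ : ∀ m n → ιℤ (m ⊖ n) ≈ ι m - ι n
  ιℤ-⊖ m zero = trans (reflexive (P.cong ιℤ (ZP.⊖-≥ {m} {0} z≤n))) (sym (x-0≈x _))
  ιℤ-⊖ zero (suc n) = trans (reflexive (P.cong ιℤ (ZP.⊖-< {0} {suc n} (s≤s z≤n)))) (sym (+-identityˡ _))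
  ιℤ-⊖ (suc m) (suc n) = begin
    ιℤ (suc m ⊖ suc n)            ≈⟨ reflexive (P.cong ιℤ (ZP.[1+m]⊖[1+n]≡m⊖n m n)) ⟩
    ιℤ (m ⊖ n)                    ≈⟨ ιℤ-⊖ m n ⟩
    ι m - ι n                     ≈⟨ sym (+-identityˡ _) ⟩
    0# + (ι m - ι n)              ≈⟨ +-congʳ (sym (-‿inverseʳ 1#)) ⟩
    (1# - 1#) + (ι m - ι n)
      ≈⟨ solve 4 (λ o x mo y → ((o :+ mo) :+ (x :+ y)) := ((o :+ x) :+ (mo :+ y))) refl 1# (ι m) (- 1#) (- ι n) ⟩
    (1# + ι m) + (- 1# + - ι n)   ≈⟨ +-congˡ (sym (-‿+ _ _)) ⟩
    (1# + ι m) - (1# + ι n)       ∎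

  ιℤ-+ : ∀ p q → ιℤ (p ℤ.+ q) ≈ ιℤ p + ιℤ q
  ιℤ-+ (+ m) (+ n) = ι-+ m n
  ιℤ-+ (+ m) -[1+ n ] = ιℤ-⊖ m (suc n)
  ιℤ-+ -[1+ m ] (+ n) = trans (ιℤ-⊖ n (suc m)) (+-comm _ _)
  ιℤ-+ -[1+ m ] -[1+ n ] = begin
    - (1# + ι (suc (m ℕ.+ n)))      ≈⟨ -‿cong (+-congˡ (+-congˡ (ι-+ m n))) ⟩
    - (1# + (1# + (ι m + ι n)))
      ≈⟨ -‿cong (solve 3 (λ o x y → (o :+ (o :+ (x :+ y))) := ((o :+ x) :+ (o :+ y))) refl 1# (ι m) (ι n)) ⟩
    - ((1# + ι m) + (1# + ι n))     ≈⟨ -‿+ _ _ ⟩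
    - (1# + ι m) + - (1# + ι n)     ∎

  ιℤ-neg : ∀ p → ιℤ (ℤ.- p) ≈ - ιℤ p
  ιℤ-neg -[1+ n ] = sym (-‿involutive _)
  ιℤ-neg (+ zero) = sym -0≈0
  ιℤ-neg (+ suc n) = refl

  ιℤ-− : ∀ p q → ιℤ (p ℤ.- q) ≈ ιℤ p - ιℤ q
  ιℤ-− p q = trans (ιℤ-+ p (ℤ.- q)) (+-congˡ (ιℤ-neg q))

  ιℤ-ℕ* : ∀ j q → ιℤ (+ j ℤ.* q) ≈ ι j * ιℤ q
  ιℤ-ℕ* zero q = sym (zeroˡ _)
  ιℤ-ℕ* (suc j) q = begin
    ιℤ (+ suc j ℤ.* q)          ≈⟨ reflexive (P.cong ιℤ (ZP.suc-* (+ j) q)) ⟩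
    ιℤ (q ℤ.+ + j ℤ.* q)        ≈⟨ ιℤ-+ q (+ j ℤ.* q) ⟩
    ιℤ q + ιℤ (+ j ℤ.* q)       ≈⟨ +-congˡ (ιℤ-ℕ* j q) ⟩
    ιℤ q + ι j * ιℤ q           ≈⟨ +-congʳ (sym (*-identityˡ _)) ⟩
    1# * ιℤ q + ι j * ιℤ q      ≈⟨ sym (distribʳ _ _ _) ⟩
    (1# + ι j) * ιℤ q           ∎

module FiniteSums {c ℓ} (F : CharZeroField c ℓ) where
  open CharZeroField F
  open Series F
  open FieldArithmetic F public

  Σ-cong : ∀ n {f g : ℕ → Carrier} → (∀ i → i ℕ.≤ n → f i ≈ g i) → Σ≤ n f ≈ Σ≤ n g
  Σ-cong zero h = h 0 z≤n
  Σ-cong (suc n) h = +-cong (Σ-cong n (λ i le → h i (NP.m≤n⇒m≤1+n le))) (h (suc n) NP.≤-refl)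

  Σ-cong′ : ∀ n {f g : ℕ → Carrier} → (∀ i → f i ≈ g i) → Σ≤ n f ≈ Σ≤ n g
  Σ-cong′ n h = Σ-cong n (λ i _ → h i)

  Σ-+ : ∀ n (f g : ℕ → Carrier) → Σ≤ n (λ i → f i + g i) ≈ Σ≤ n f + Σ≤ n g
  Σ-+ zero f g = refl
  Σ-+ (suc n) f g = trans (+-congʳ (Σ-+ n f g))
    (solve 4 (λ a b c d → ((a :+ b) :+ (c :+ d)) := ((a :+ c) :+ (b :+ d))) refl _ _ _ _)

  Σ-*ˡ : ∀ n x (f : ℕ → Carrier) → x * Σ≤ n f ≈ Σ≤ n (λ i → x * f i)
  Σ-*ˡ zero x f = refl
  Σ-*ˡ (suc n) x f = trans (distribˡ _ _ _) (+-congʳ (Σ-*ˡ n x f))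

  Σ-*ʳ : ∀ n x (f : ℕ → Carrier) → Σ≤ n f * x ≈ Σ≤ n (λ i → f i * x)
  Σ-*ʳ n x f = trans (*-comm _ _) (trans (Σ-*ˡ n x f) (Σ-cong′ n (λ i → *-comm _ _)))

  Σ-neg : ∀ n (f : ℕ → Carrier) → Σ≤ n (λ i → - f i) ≈ - Σ≤ n f
  Σ-neg zero f = refl
  Σ-neg (suc n) f = trans (+-congʳ (Σ-neg n f)) (sym (-‿+ _ _))

  Σ-− : ∀ n (f g : ℕ → Carrier) → Σ≤ n (λ i → f i - g i) ≈ Σ≤ n f - Σ≤ n g
  Σ-− n f g = trans (Σ-+ n f (λ i → - g i)) (+-congˡ (Σ-neg n g))

  Σ-0 : ∀ n {f : ℕ → Carrier} → (∀ i → i ℕ.≤ n → f i ≈ 0#) → Σ≤ n f ≈ 0#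
  Σ-0 zero h = h 0 z≤n
  Σ-0 (suc n) h = trans (+-cong (Σ-0 n (λ i le → h i (NP.m≤n⇒m≤1+n le))) (h (suc n) NP.≤-refl)) (+-identityʳ _)

  Σ-head : ∀ n (f : ℕ → Carrier) → Σ≤ (suc n) f ≈ f 0 + Σ≤ n (λ i → f (suc i))
  Σ-head zero f = refl
  Σ-head (suc n) f = trans (+-congʳ (Σ-head n f)) (+-assoc _ _ _)

  Σ-only-head : ∀ n (f : ℕ → Carrier) → (∀ i → f (suc i) ≈ 0#) → Σ≤ n f ≈ f 0
  Σ-only-head zero f h = refl
  Σ-only-head (suc n) f h = trans (Σ-head n f) (trans (+-congˡ (Σ-0 n (λ i _ → h i))) (+-identityʳ _))

  Σ-drop : ∀ m n (f : ℕ → Carrier) → (∀ i → i ℕ.< m → f i ≈ 0#) → m ℕ.≤ n →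
           Σ≤ n f ≈ Σ≤ (n ∸ m) (λ k → f (m ℕ.+ k))
  Σ-drop zero n f h le = refl
  Σ-drop (suc m) (suc n) f h (s≤s le) = begin
    Σ≤ (suc n) f                            ≈⟨ Σ-head n f ⟩
    f 0 + Σ≤ n (λ i → f (suc i))            ≈⟨ +-congʳ (h 0 (s≤s z≤n)) ⟩
    0# + Σ≤ n (λ i → f (suc i))             ≈⟨ +-identityˡ _ ⟩
    Σ≤ n (λ i → f (suc i))                  ≈⟨ Σ-drop m n (λ i → f (suc i)) (λ i lt → h (suc i) (s≤s lt)) le ⟩
    Σ≤ (n ∸ m) (λ k → f (suc (m ℕ.+ k)))    ∎

  Σ-truncate : ∀ n m (f : ℕ → Carrier) → n ℕ.≤ m → (∀ i → n ℕ.< i → i ℕ.≤ m → f i ≈ 0#) →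
               Σ≤ m f ≈ Σ≤ n f
  Σ-truncate n zero f z≤n h = refl
  Σ-truncate n (suc m) f le h with NP.m≤n⇒m<n∨m≡n le
  ... | inj₂ P.refl = refl
  ... | inj₁ (s≤s lt) = begin
    Σ≤ m f + f (suc m)
      ≈⟨ +-cong (Σ-truncate n m f lt (λ i a b → h i a (NP.m≤n⇒m≤1+n b))) (h (suc m) (s≤s lt) NP.≤-refl) ⟩
    Σ≤ n f + 0#     ≈⟨ +-identityʳ _ ⟩
    Σ≤ n f          ∎

  Σ-reverse : ∀ n (f : ℕ → Carrier) → Σ≤ n f ≈ Σ≤ n (λ i → f (n ∸ i))
  Σ-reverse zero f = refl
  Σ-reverse (suc n) f = begin
    Σ≤ n f + f (suc n)                       ≈⟨ +-comm _ _ ⟩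
    f (suc n) + Σ≤ n f                       ≈⟨ +-congˡ (Σ-reverse n f) ⟩
    f (suc n) + Σ≤ n (λ i → f (n ∸ i))       ≈⟨ sym (Σ-head n (λ i → f (suc n ∸ i))) ⟩
    Σ≤ (suc n) (λ i → f (suc n ∸ i))         ∎

  Σ-swap : ∀ n (φ : ℕ → ℕ → Carrier) →
    Σ≤ n (λ i → Σ≤ i (λ j → φ i j)) ≈ Σ≤ n (λ j → Σ≤ (n ∸ j) (λ k → φ (j ℕ.+ k) j))
  Σ-swap zero φ = refl
  Σ-swap (suc n) φ = begin
    Σ≤ n (λ i → Σ≤ i (φ i)) + Σ≤ (suc n) (φ (suc n))
      ≈⟨ +-congʳ (Σ-swap n φ) ⟩
    Σ≤ n (λ j → inner n j) + (Σ≤ n (φ (suc n)) + φ (suc n) (suc n))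
      ≈⟨ sym (+-assoc _ _ _) ⟩
    (Σ≤ n (λ j → inner n j) + Σ≤ n (φ (suc n))) + φ (suc n) (suc n)
      ≈⟨ +-cong (sym (Σ-+ n _ _))
                (reflexive (P.trans (P.cong (λ z → φ z (suc n)) (P.sym (NP.+-identityʳ (suc n)))) (P.sym (last n)))) ⟩
    Σ≤ n (λ j → inner n j + φ (suc n) j) + inner (suc n) (suc n)
      ≈⟨ +-congʳ (Σ-cong n (λ j le → extend j le)) ⟩
    Σ≤ n (λ j → inner (suc n) j) + inner (suc n) (suc n) ∎
    where
    inner : ℕ → ℕ → Carrier
    inner m j = Σ≤ (m ∸ j) (λ k → φ (j ℕ.+ k) j)
    last : ∀ m → inner (suc m) (suc m) ≡ φ (suc m ℕ.+ 0) (suc m)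
    last m = P.cong (λ r → Σ≤ r (λ k → φ (suc m ℕ.+ k) (suc m))) (NP.n∸n≡0 m)
    extend : ∀ j → j ℕ.≤ n → inner n j + φ (suc n) j ≈ inner (suc n) j
    extend j le = begin
      inner n j + φ (suc n) j
        ≈⟨ +-congˡ (reflexive (P.cong (λ z → φ z j)
             (P.trans (P.cong suc (P.sym (NP.m+[n∸m]≡n le))) (P.sym (NP.+-suc j (n ∸ j)))))) ⟩
      Σ≤ (suc (n ∸ j)) (λ k → φ (j ℕ.+ k) j)
        ≈⟨ reflexive (P.cong (λ r → Σ≤ r (λ k → φ (j ℕ.+ k) j)) (P.sym (NP.+-∸-assoc 1 le))) ⟩
      inner (suc n) j ∎

module PowerSeries {c ℓ} (F : CharZeroField c ℓ) where
  open CharZeroField F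
  open Series F
  open FiniteSums F public

  infix 4 _≐_
  record _≐_ (f g : FPS) : Set ℓ where
    constructor mk
    field at : ∀ n → f n ≈ g n
  open _≐_ public

  ≐refl : ∀ {f} → f ≐ f
  ≐refl = mk (λ n → refl)
  ≐sym : ∀ {f g} → f ≐ g → g ≐ f
  ≐sym p = mk (λ n → sym (at p n))
  ≐trans : ∀ {f g h} → f ≐ g → g ≐ h → f ≐ h
  ≐trans p q = mk (λ n → trans (at p n) (at q n))

  infixr 2 _≐⟨_⟩_
  infix 3 _≐∎
  _≐⟨_⟩_ : ∀ f {g h : FPS} → f ≐ g → g ≐ h → f ≐ h
  f ≐⟨ p ⟩ q = ≐trans p q
  _≐∎ : ∀ f → f ≐ f
  f ≐∎ = ≐refl

  infixl 6 _+ₛ_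
  _+ₛ_ : FPS → FPS → FPS
  (f +ₛ g) n = f n + g n

  0ₛ : FPS
  0ₛ _ = 0#

  +ₛ-cong : ∀ {f f′ g g′} → f ≐ f′ → g ≐ g′ → f +ₛ g ≐ f′ +ₛ g′
  +ₛ-cong p q = mk (λ n → +-cong (at p n) (at q n))

  scale-cong : ∀ {x y f g} → x ≈ y → f ≐ g → scale x f ≐ scale y g
  scale-cong e p = mk (λ n → *-cong e (at p n))

  ⋆-cong≤ : ∀ n {f f′ g g′} → (∀ i → i ℕ.≤ n → f i ≈ f′ i) → (∀ i → i ℕ.≤ n → g i ≈ g′ i) →
            (f ⋆ g) n ≈ (f′ ⋆ g′) n
  ⋆-cong≤ n p q = Σ-cong n (λ i le → *-cong (p i le) (q (n ∸ i) (NP.m∸n≤m n i)))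

  ⋆-cong : ∀ {f f′ g g′} → f ≐ f′ → g ≐ g′ → f ⋆ g ≐ f′ ⋆ g′
  ⋆-cong p q = mk (λ n → ⋆-cong≤ n (λ i _ → at p i) (λ i _ → at q i))

  ⋆-congˡ : ∀ f {g g′} → g ≐ g′ → f ⋆ g ≐ f ⋆ g′
  ⋆-congˡ f = ⋆-cong (≐refl {f})

  ⋆-congʳ : ∀ g {f f′} → f ≐ f′ → f ⋆ g ≐ f′ ⋆ g
  ⋆-congʳ g p = ⋆-cong p (≐refl {g})

  ⋆-comm : ∀ f g → f ⋆ g ≐ g ⋆ f
  ⋆-comm f g = mk λ n → begin
    Σ≤ n (λ i → f i * g (n ∸ i))
      ≈⟨ Σ-reverse n _ ⟩
    Σ≤ n (λ i → f (n ∸ i) * g (n ∸ (n ∸ i)))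
      ≈⟨ Σ-cong n (λ i le → trans (*-comm _ _) (*-congʳ (reflexive (P.cong g (NP.m∸[m∸n]≡n le))))) ⟩
    Σ≤ n (λ i → g i * f (n ∸ i)) ∎

  ⋆-assoc : ∀ f g h → (f ⋆ g) ⋆ h ≐ f ⋆ (g ⋆ h)
  ⋆-assoc f g h = mk λ n → begin
    Σ≤ n (λ i → Σ≤ i (λ j → f j * g (i ∸ j)) * h (n ∸ i))
      ≈⟨ Σ-cong′ n (λ i → Σ-*ʳ i _ _) ⟩
    Σ≤ n (λ i → Σ≤ i (λ j → f j * g (i ∸ j) * h (n ∸ i)))
      ≈⟨ Σ-swap n _ ⟩
    Σ≤ n (λ j → Σ≤ (n ∸ j) (λ k → f j * g ((j ℕ.+ k) ∸ j) * h (n ∸ (j ℕ.+ k))))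
      ≈⟨ Σ-cong′ n (λ j → Σ-cong′ (n ∸ j) (λ k → trans (*-assoc _ _ _)
           (*-congˡ (*-cong (reflexive (P.cong g (NP.m+n∸m≡n j k)))
                            (reflexive (P.cong h (P.sym (NP.∸-+-assoc n j k)))))))) ⟩
    Σ≤ n (λ j → Σ≤ (n ∸ j) (λ k → f j * (g k * h ((n ∸ j) ∸ k))))
      ≈⟨ Σ-cong′ n (λ j → sym (Σ-*ˡ (n ∸ j) _ _)) ⟩
    Σ≤ n (λ j → f j * Σ≤ (n ∸ j) (λ k → g k * h ((n ∸ j) ∸ k))) ∎

  ⋆-identityˡ : ∀ f → one ⋆ f ≐ f
  ⋆-identityˡ f = mk λ n →
    trans (Σ-only-head n (λ i → one i * f (n ∸ i)) (λ i → zeroˡ _)) (*-identityˡ _)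

  ⋆-identityʳ : ∀ f → f ⋆ one ≐ f
  ⋆-identityʳ f = ≐trans (⋆-comm f one) (⋆-identityˡ f)

  ⋆-distribˡ : ∀ f g h → f ⋆ (g +ₛ h) ≐ (f ⋆ g) +ₛ (f ⋆ h)
  ⋆-distribˡ f g h = mk λ n → trans (Σ-cong′ n (λ i → distribˡ _ _ _)) (Σ-+ n _ _)

  ⋆-distribʳ : ∀ f g h → (g +ₛ h) ⋆ f ≐ (g ⋆ f) +ₛ (h ⋆ f)
  ⋆-distribʳ f g h =
    ≐trans (⋆-comm (g +ₛ h) f) (≐trans (⋆-distribˡ f g h) (+ₛ-cong (⋆-comm f g) (⋆-comm f h)))

  ⋆-zeroʳ : ∀ f → f ⋆ 0ₛ ≐ 0ₛ
  ⋆-zeroʳ f = mk λ n → Σ-0 n (λ i _ → zeroʳ _)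

  ⋆-commutativeMonoid : CommutativeMonoid c ℓ
  ⋆-commutativeMonoid = record
    { Carrier = FPS ; _≈_ = _≐_ ; _∙_ = _⋆_ ; ε = one
    ; isCommutativeMonoid = record
      { isMonoid = record
        { isSemigroup = record
          { isMagma = record
            { isEquivalence = record { refl = ≐refl ; sym = ≐sym ; trans = ≐trans }
            ; ∙-cong = ⋆-cong }
          ; assoc = ⋆-assoc }
        ; identity = ⋆-identityˡ , ⋆-identityʳ }
      ; comm = ⋆-comm } }

  open CommutativeSemigroupProperties (CommutativeMonoid.commutativeSemigroup ⋆-commutativeMonoid) public
    using ()
    renaming (interchange to ⋆-interchange; x∙yz≈y∙xz to ⋆-swap; xy∙z≈xz∙y to ⋆-swapʳ; x∙yz≈xz∙y to ⋆-rotate)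
  module ⋆-Solver = CommutativeMonoidSolver ⋆-commutativeMonoid

  scale-⋆ˡ : ∀ x f g → scale x f ⋆ g ≐ scale x (f ⋆ g)
  scale-⋆ˡ x f g = mk λ n → trans (Σ-cong′ n (λ i → *-assoc _ _ _)) (sym (Σ-*ˡ n x _))

  scale-⋆ʳ : ∀ x f g → f ⋆ scale x g ≐ scale x (f ⋆ g)
  scale-⋆ʳ x f g = ≐trans (⋆-comm f (scale x g)) (≐trans (scale-⋆ˡ x g f) (scale-cong refl (⋆-comm g f)))

  scale-scale : ∀ x y f → scale x (scale y f) ≐ scale (x * y) f
  scale-scale x y f = mk λ n → sym (*-assoc _ _ _)

  scale-+ : ∀ x y f → scale x f +ₛ scale y f ≐ scale (x + y) f
  scale-+ x y f = mk λ n → sym (distribʳ _ _ _)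

  scale-1 : ∀ f → scale 1# f ≐ f
  scale-1 f = mk λ n → *-identityˡ _

  scale-cancel : ∀ {x f g} → ¬ (x ≈ 0#) → scale x f ≐ scale x g → f ≐ g
  scale-cancel nz p = mk λ n → cancelˡ nz (at p n)

  ^ₛ-cong : ∀ {f g} j → f ≐ g → f ^ₛ j ≐ g ^ₛ j
  ^ₛ-cong zero p = ≐refl
  ^ₛ-cong (suc j) p = ⋆-cong p (^ₛ-cong j p)

  ^ₛ-one : ∀ j → one ^ₛ j ≐ one
  ^ₛ-one zero = ≐refl
  ^ₛ-one (suc j) = ≐trans (⋆-identityˡ (one ^ₛ j)) (^ₛ-one j)

  ^ₛ-⋆ : ∀ f g j → (f ⋆ g) ^ₛ j ≐ (f ^ₛ j) ⋆ (g ^ₛ j)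
  ^ₛ-⋆ f g zero = ≐sym (⋆-identityˡ one)
  ^ₛ-⋆ f g (suc j) =
    (f ⋆ g) ⋆ ((f ⋆ g) ^ₛ j)           ≐⟨ ⋆-congˡ (f ⋆ g) (^ₛ-⋆ f g j) ⟩
    (f ⋆ g) ⋆ ((f ^ₛ j) ⋆ (g ^ₛ j))     ≐⟨ ⋆-interchange f g (f ^ₛ j) (g ^ₛ j) ⟩
    (f ⋆ (f ^ₛ j)) ⋆ (g ⋆ (g ^ₛ j))     ≐∎

  ^ₛ-scale : ∀ x f j → scale x f ^ₛ j ≐ scale (x ^ j) (f ^ₛ j)
  ^ₛ-scale x f zero = mk λ n → sym (*-identityˡ _)
  ^ₛ-scale x f (suc j) =
    scale x f ⋆ (scale x f ^ₛ j)                ≐⟨ ⋆-congˡ (scale x f) (^ₛ-scale x f j) ⟩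
    scale x f ⋆ scale (x ^ j) (f ^ₛ j)          ≐⟨ scale-⋆ˡ x f (scale (x ^ j) (f ^ₛ j)) ⟩
    scale x (f ⋆ scale (x ^ j) (f ^ₛ j))        ≐⟨ scale-cong refl (scale-⋆ʳ (x ^ j) f (f ^ₛ j)) ⟩
    scale x (scale (x ^ j) (f ^ₛ (suc j)))      ≐⟨ scale-scale x (x ^ j) (f ^ₛ suc j) ⟩
    scale (x ^ suc j) (f ^ₛ suc j)              ≐∎

  t⋆-zero : ∀ f → (tₛ ⋆ f) 0 ≈ 0#
  t⋆-zero f = zeroˡ _

  t⋆-suc : ∀ f n → (tₛ ⋆ f) (suc n) ≈ f n
  t⋆-suc f n = begin
    Σ≤ (suc n) (λ i → tₛ i * f (suc n ∸ i))             ≈⟨ Σ-head n _ ⟩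
    0# * f (suc n) + Σ≤ n (λ i → tₛ (suc i) * f (n ∸ i)) ≈⟨ +-cong (zeroˡ _) (Σ-only-head n _ (λ i → zeroˡ _)) ⟩
    0# + 1# * f n                                        ≈⟨ +-identityˡ _ ⟩
    1# * f n                                             ≈⟨ *-identityˡ _ ⟩
    f n                                                  ∎

  t-cancel : ∀ {f g} → tₛ ⋆ f ≐ tₛ ⋆ g → f ≐ g
  t-cancel {f} {g} p = mk λ n → trans (sym (t⋆-suc f n)) (trans (at p (suc n)) (t⋆-suc g n))

  t-pow : ∀ j k → (tₛ ^ₛ j) (j ℕ.+ k) ≈ one k
  t-pow zero k = refl
  t-pow (suc j) k = trans (t⋆-suc (tₛ ^ₛ j) (j ℕ.+ k)) (t-pow j k)

-- The product rule
-- is proved for θ, where it is a coefficientwise identity, and transferred to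
-- D by cancelling t.  Because the characteristic is zero, a series is
-- determined by its constant term and its derivative, so the linear equation
-- f' = f·q has at most one solution with a given constant term.
module Derivative {c ℓ} (F : CharZeroField c ℓ) where
  open CharZeroField F hiding (zero)
  open Series F
  open PowerSeries F public

  D : FPS → FPS
  D f n = ι (suc n) * f (suc n)

  θ : FPS → FPS
  θ f n = ι n * f n

  D-+ : ∀ f g → D (f +ₛ g) ≐ D f +ₛ D g
  D-+ f g = mk λ n → distribˡ _ _ _

  D-scale : ∀ x f → D (scale x f) ≐ scale x (D f)
  D-scale x f = mk λ n → solve 3 (λ a b c → (a :* (b :* c)) := (b :* (a :* c))) refl _ _ _

  D-one : D one ≐ 0ₛ
  D-one = mk λ n → zeroʳ _

  t⋆D : ∀ f → tₛ ⋆ D f ≐ θ f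
  t⋆D f = mk λ { zero → trans (t⋆-zero (D f)) (sym (zeroˡ _)) ; (suc n) → t⋆-suc (D f) n }

  θ-⋆ : ∀ f g → θ (f ⋆ g) ≐ (θ f ⋆ g) +ₛ (f ⋆ θ g)
  θ-⋆ f g = mk λ n → trans (Σ-*ˡ n _ _) (trans (Σ-cong n (split n)) (Σ-+ n _ _))
    where
    -- n = i + (n - i) distributes over the term f_i g_{n-i}
    split : ∀ n i → i ℕ.≤ n →
            ι n * (f i * g (n ∸ i)) ≈ ι i * f i * g (n ∸ i) + f i * (ι (n ∸ i) * g (n ∸ i))
    split n i le = begin
      ι n * (f i * g (n ∸ i))                  ≈⟨ *-congʳ (reflexive (P.cong ι (P.sym (NP.m+[n∸m]≡n le)))) ⟩
      ι (i ℕ.+ (n ∸ i)) * (f i * g (n ∸ i))    ≈⟨ *-congʳ (ι-+ i (n ∸ i)) ⟩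
      (ι i + ι (n ∸ i)) * (f i * g (n ∸ i))
        ≈⟨ solve 4 (λ a b x y → ((a :+ b) :* (x :* y)) := (a :* x :* y :+ x :* (b :* y))) refl _ _ _ _ ⟩
      ι i * f i * g (n ∸ i) + f i * (ι (n ∸ i) * g (n ∸ i)) ∎

  Leibniz : ∀ f g → D (f ⋆ g) ≐ (D f ⋆ g) +ₛ (f ⋆ D g)
  Leibniz f g = t-cancel (
    tₛ ⋆ D (f ⋆ g)                              ≐⟨ t⋆D (f ⋆ g) ⟩
    θ (f ⋆ g)                                   ≐⟨ θ-⋆ f g ⟩
    (θ f ⋆ g) +ₛ (f ⋆ θ g)
      ≐⟨ +ₛ-cong (≐trans (⋆-congʳ g (≐sym (t⋆D f))) (⋆-assoc tₛ (D f) g))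
                 (≐trans (⋆-congˡ f (≐sym (t⋆D g))) (⋆-swap f tₛ (D g))) ⟩
    (tₛ ⋆ (D f ⋆ g)) +ₛ (tₛ ⋆ (f ⋆ D g))        ≐⟨ ≐sym (⋆-distribˡ tₛ (D f ⋆ g) (f ⋆ D g)) ⟩
    tₛ ⋆ ((D f ⋆ g) +ₛ (f ⋆ D g))               ≐∎)

  D-injective : ∀ {f g} → f 0 ≈ g 0 → D f ≐ D g → f ≐ g
  D-injective h0 p = mk λ { zero → h0 ; (suc n) → cancelˡ (char0 n) (at p n) }

  ODE-unique : ∀ {f g} q → D f ≐ f ⋆ q → D g ≐ g ⋆ q → f 0 ≈ g 0 → f ≐ g
  ODE-unique {f} {g} q pf pg h0 = mk λ n → agree n n NP.≤-refl
    where
    agree : ∀ n i → i ℕ.≤ n → f i ≈ g i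
    agree zero .zero z≤n = h0
    agree (suc n) i le with NP.m≤n⇒m<n∨m≡n le
    ... | inj₁ (s≤s lt) = agree n i lt
    ... | inj₂ P.refl = cancelˡ (char0 n)
      (trans (at pf n) (trans (⋆-cong≤ n {g = q} {g′ = q} (agree n) (λ _ _ → refl)) (sym (at pg n))))

  power-rule : ∀ g j → D (g ^ₛ suc j) ≐ scale (ι (suc j)) ((g ^ₛ j) ⋆ D g)
  power-rule g zero =
    D (g ⋆ one)                   ≐⟨ Leibniz g one ⟩
    (D g ⋆ one) +ₛ (g ⋆ D one)    ≐⟨ +ₛ-cong (⋆-identityʳ (D g)) (≐trans (⋆-congˡ g D-one) (⋆-zeroʳ g)) ⟩
    D g +ₛ 0ₛ                     ≐⟨ mk (λ n → trans (+-identityʳ _) (sym (*-identityˡ _))) ⟩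
    scale 1# (D g)                ≐⟨ scale-cong (sym ι1) (≐sym (⋆-identityˡ (D g))) ⟩
    scale (ι 1) (one ⋆ D g)       ≐∎
  power-rule g (suc j) =
    D (g ⋆ (g ^ₛ suc j))
      ≐⟨ Leibniz g (g ^ₛ suc j) ⟩
    (D g ⋆ (g ^ₛ suc j)) +ₛ (g ⋆ D (g ^ₛ suc j))
      ≐⟨ +ₛ-cong (≐trans (⋆-comm (D g) (g ^ₛ suc j)) (≐sym (scale-1 _))) (⋆-congˡ g (power-rule g j)) ⟩
    scale 1# ((g ^ₛ suc j) ⋆ D g) +ₛ (g ⋆ scale (ι (suc j)) ((g ^ₛ j) ⋆ D g))
      ≐⟨ +ₛ-cong ≐refl (≐trans (scale-⋆ʳ (ι (suc j)) g ((g ^ₛ j) ⋆ D g))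
                               (scale-cong refl (≐sym (⋆-assoc g (g ^ₛ j) (D g))))) ⟩
    scale 1# ((g ^ₛ suc j) ⋆ D g) +ₛ scale (ι (suc j)) ((g ^ₛ suc j) ⋆ D g)
      ≐⟨ scale-+ _ _ _ ⟩
    scale (ι (suc (suc j))) ((g ^ₛ suc j) ⋆ D g) ≐∎

-- The coefficient
-- formula for f(g)·h reduces the chain rule to the power rule; the chain and
-- product rules together with ODE-style induction on the coefficient index
-- show that composition with g is multiplicative.
module Composition {c ℓ} (F : CharZeroField c ℓ) where
  open CharZeroField F hiding (zero)
  open Series F
  open Derivative F public

  pow-vanishes : ∀ {g} → g 0 ≈ 0# → ∀ j i → i ℕ.< j → (g ^ₛ j) i ≈ 0#
  pow-vanishes {g} g0 (suc j) i (s≤s lt) = Σ-0 i term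
    where
    term : ∀ k → k ℕ.≤ i → g k * (g ^ₛ j) (i ∸ k) ≈ 0#
    term zero _ = trans (*-congʳ g0) (zeroˡ _)
    term (suc k) le =
      trans (*-congˡ (pow-vanishes g0 j (i ∸ suc k) (NP.<-≤-trans (NP.∸-monoʳ-< (s≤s z≤n) le) lt))) (zeroʳ _)

  comp-zero : ∀ f g → (f ∘ₛ g) 0 ≈ f 0
  comp-zero f g = *-identityʳ _

  comp-congˡ : ∀ {f f′} g → f ≐ f′ → f ∘ₛ g ≐ f′ ∘ₛ g
  comp-congˡ g p = mk λ n → Σ-cong′ n (λ j → *-congʳ (at p j))

  comp-congʳ : ∀ f {g g′} → g ≐ g′ → f ∘ₛ g ≐ f ∘ₛ g′
  comp-congʳ f p = mk λ n → Σ-cong′ n (λ j → *-congˡ (at (^ₛ-cong j p) n))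

  comp-+ : ∀ f h g → (f +ₛ h) ∘ₛ g ≐ (f ∘ₛ g) +ₛ (h ∘ₛ g)
  comp-+ f h g = mk λ n → trans (Σ-cong′ n (λ j → distribʳ _ _ _)) (Σ-+ n _ _)

  comp-− : ∀ f h g → (f -ₛ h) ∘ₛ g ≐ (f ∘ₛ g) -ₛ (h ∘ₛ g)
  comp-− f h g = mk λ n → trans (Σ-cong′ n (λ j → [y-z]x≈yx-zx _ _ _)) (Σ-− n _ _)

  comp-one : ∀ g → one ∘ₛ g ≐ one
  comp-one g = mk λ n → trans (Σ-only-head n _ (λ j → zeroˡ _)) (*-identityˡ _)

  comp-t : ∀ {g} → g 0 ≈ 0# → tₛ ∘ₛ g ≐ g
  comp-t {g} g0 = mk coeff
    where
    coeff : ∀ n → (tₛ ∘ₛ g) n ≈ g n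
    coeff zero = trans (zeroˡ _) (sym g0)
    coeff (suc n) = begin
      Σ≤ (suc n) (λ j → tₛ j * (g ^ₛ j) (suc n))
        ≈⟨ Σ-head n _ ⟩
      0# * one (suc n) + Σ≤ n (λ j → tₛ (suc j) * (g ^ₛ suc j) (suc n))
        ≈⟨ +-cong (zeroˡ _) (Σ-only-head n _ (λ j → zeroˡ _)) ⟩
      0# + 1# * (g ⋆ one) (suc n)
        ≈⟨ trans (+-identityˡ _) (*-identityˡ _) ⟩
      (g ⋆ one) (suc n)
        ≈⟨ at (⋆-identityʳ g) (suc n) ⟩
      g (suc n) ∎

  comp-⋆-coeff : ∀ f {g} h → g 0 ≈ 0# → ∀ n → ((f ∘ₛ g) ⋆ h) n ≈ Σ≤ n (λ m → f m * ((g ^ₛ m) ⋆ h) n)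
  comp-⋆-coeff f {g} h g0 n = begin
    Σ≤ n (λ i → Σ≤ i (λ m → f m * (g ^ₛ m) i) * h (n ∸ i))
      ≈⟨ Σ-cong′ n (λ i → Σ-*ʳ i _ _) ⟩
    Σ≤ n (λ i → Σ≤ i (λ m → f m * (g ^ₛ m) i * h (n ∸ i)))
      ≈⟨ Σ-swap n _ ⟩
    Σ≤ n (λ m → Σ≤ (n ∸ m) (λ k → f m * (g ^ₛ m) (m ℕ.+ k) * h (n ∸ (m ℕ.+ k))))
      ≈⟨ Σ-cong n (λ m le → trans (Σ-cong′ (n ∸ m) (λ k → *-assoc _ _ _))
            (trans (sym (Σ-*ˡ (n ∸ m) _ _))
              (*-congˡ (sym (Σ-drop m n _ (λ i lt → trans (*-congʳ (pow-vanishes g0 m i lt)) (zeroˡ _)) le))))) ⟩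
    Σ≤ n (λ m → f m * Σ≤ n (λ i → (g ^ₛ m) i * h (n ∸ i))) ∎

  chain-rule : ∀ f {g} → g 0 ≈ 0# → D (f ∘ₛ g) ≐ (D f ∘ₛ g) ⋆ D g
  chain-rule f {g} g0 = mk λ n → begin
    ι (suc n) * Σ≤ (suc n) (λ j → f j * (g ^ₛ j) (suc n))
      ≈⟨ *-congˡ (trans (Σ-head n _) (trans (+-congʳ (zeroʳ _)) (+-identityˡ _))) ⟩
    ι (suc n) * Σ≤ n (λ j → f (suc j) * (g ^ₛ suc j) (suc n))
      ≈⟨ Σ-*ˡ n _ _ ⟩
    Σ≤ n (λ j → ι (suc n) * (f (suc j) * (g ^ₛ suc j) (suc n)))
      ≈⟨ Σ-cong′ n (λ j → trans (solve 3 (λ a b x → (a :* (b :* x)) := (b :* (a :* x))) refl _ _ _)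
            (trans (*-congˡ (at (power-rule g j) n))
                   (solve 3 (λ a b x → (a :* (b :* x)) := ((b :* a) :* x)) refl _ _ _))) ⟩
    Σ≤ n (λ j → D f j * ((g ^ₛ j) ⋆ D g) n)
      ≈⟨ sym (comp-⋆-coeff (D f) (D g) g0 n) ⟩
    ((D f ∘ₛ g) ⋆ D g) n ∎

  comp-⋆ : ∀ f h {g} → g 0 ≈ 0# → (f ⋆ h) ∘ₛ g ≐ (f ∘ₛ g) ⋆ (h ∘ₛ g)
  comp-⋆ f h {g} g0 = mk λ n → agree n f h n NP.≤-refl
    where
    D-rhs : ∀ f h → D ((f ∘ₛ g) ⋆ (h ∘ₛ g)) ≐
            (((D f ∘ₛ g) ⋆ (h ∘ₛ g)) +ₛ ((f ∘ₛ g) ⋆ (D h ∘ₛ g))) ⋆ D g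
    D-rhs f h =
      D ((f ∘ₛ g) ⋆ (h ∘ₛ g))
        ≐⟨ Leibniz (f ∘ₛ g) (h ∘ₛ g) ⟩
      (D (f ∘ₛ g) ⋆ (h ∘ₛ g)) +ₛ ((f ∘ₛ g) ⋆ D (h ∘ₛ g))
        ≐⟨ +ₛ-cong (⋆-congʳ (h ∘ₛ g) (chain-rule f g0)) (⋆-congˡ (f ∘ₛ g) (chain-rule h g0)) ⟩
      (((D f ∘ₛ g) ⋆ D g) ⋆ (h ∘ₛ g)) +ₛ ((f ∘ₛ g) ⋆ ((D h ∘ₛ g) ⋆ D g))
        ≐⟨ +ₛ-cong (⋆-swapʳ (D f ∘ₛ g) (D g) (h ∘ₛ g)) (≐sym (⋆-assoc (f ∘ₛ g) (D h ∘ₛ g) (D g))) ⟩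
      (((D f ∘ₛ g) ⋆ (h ∘ₛ g)) ⋆ D g) +ₛ (((f ∘ₛ g) ⋆ (D h ∘ₛ g)) ⋆ D g)
        ≐⟨ ≐sym (⋆-distribʳ (D g) _ _) ⟩
      (((D f ∘ₛ g) ⋆ (h ∘ₛ g)) +ₛ ((f ∘ₛ g) ⋆ (D h ∘ₛ g))) ⋆ D g ≐∎
    -- both sides agree up to degree n, for all f and h simultaneously
    agree : ∀ n f h i → i ℕ.≤ n → ((f ⋆ h) ∘ₛ g) i ≈ ((f ∘ₛ g) ⋆ (h ∘ₛ g)) i
    agree zero f h .zero z≤n = trans (*-identityʳ _) (sym (*-cong (*-identityʳ _) (*-identityʳ _)))
    agree (suc n) f h i le with NP.m≤n⇒m<n∨m≡n le
    ... | inj₁ (s≤s lt) = agree n f h i lt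
    ... | inj₂ P.refl = cancelˡ (char0 n) (begin
      D ((f ⋆ h) ∘ₛ g) n
        ≈⟨ at (chain-rule (f ⋆ h) g0) n ⟩
      ((D (f ⋆ h) ∘ₛ g) ⋆ D g) n
        ≈⟨ at (⋆-congʳ (D g) (≐trans (comp-congˡ g (Leibniz f h)) (comp-+ (D f ⋆ h) (f ⋆ D h) g))) n ⟩
      ((((D f ⋆ h) ∘ₛ g) +ₛ ((f ⋆ D h) ∘ₛ g)) ⋆ D g) n
        ≈⟨ ⋆-cong≤ n {g = D g} {g′ = D g} (λ i le → +-cong (agree n (D f) h i le) (agree n f (D h) i le))
                   (λ _ _ → refl) ⟩
      ((((D f ∘ₛ g) ⋆ (h ∘ₛ g)) +ₛ ((f ∘ₛ g) ⋆ (D h ∘ₛ g))) ⋆ D g) n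
        ≈⟨ sym (at (D-rhs f h) n) ⟩
      D ((f ∘ₛ g) ⋆ (h ∘ₛ g)) n ∎)

  comp-^ : ∀ f {g} → g 0 ≈ 0# → ∀ j → (f ^ₛ j) ∘ₛ g ≐ (f ∘ₛ g) ^ₛ j
  comp-^ f {g} g0 zero = comp-one g
  comp-^ f {g} g0 (suc j) = ≐trans (comp-⋆ f (f ^ₛ j) g0) (⋆-congˡ (f ∘ₛ g) (comp-^ f g0 j))

  comp-dilation : ∀ f x n → (f ∘ₛ scale x tₛ) n ≈ x ^ n * f n
  comp-dilation f x n = begin
    Σ≤ n (λ j → f j * (scale x tₛ ^ₛ j) n)    ≈⟨ Σ-cong′ n (λ j → *-congˡ (at (^ₛ-scale x tₛ j) n)) ⟩
    Σ≤ n (λ j → f j * (x ^ j * (tₛ ^ₛ j) n))  ≈⟨ Σ-truncate-front n ⟩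
    f n * (x ^ n * (tₛ ^ₛ n) n)
      ≈⟨ *-congˡ (*-congˡ (trans (reflexive (P.cong (tₛ ^ₛ n) (P.sym (NP.+-identityʳ n)))) (t-pow n 0))) ⟩
    f n * (x ^ n * 1#)                        ≈⟨ trans (*-congˡ (*-identityʳ _)) (*-comm _ _) ⟩
    x ^ n * f n                               ∎
    where
    Σ-truncate-front : ∀ n → Σ≤ n (λ j → f j * (x ^ j * (tₛ ^ₛ j) n)) ≈ f n * (x ^ n * (tₛ ^ₛ n) n)
    Σ-truncate-front zero = refl
    Σ-truncate-front (suc n) = trans (+-congʳ (Σ-0 n below)) (+-identityˡ _)
      where
      below : ∀ j → j ℕ.≤ n → f j * (x ^ j * (tₛ ^ₛ j) (suc n)) ≈ 0#
      below j le = trans (*-congˡ (*-congˡ (trans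
        (reflexive (P.cong (tₛ ^ₛ j) (P.sym (NP.m+[n∸m]≡n (NP.m≤n⇒m≤1+n le)))))
        (trans (t-pow j (suc n ∸ j)) (reflexive (P.cong one (NP.+-∸-assoc 1 le)))))))
        (trans (*-congˡ (zeroʳ _)) (zeroʳ _))

module ElementarySeries {c ℓ} (F : CharZeroField c ℓ) where
  open CharZeroField F hiding (zero)
  open Series F
  open Composition F public

  inv-ι1 : (ι 1) ⁻¹ ≈ 1#
  inv-ι1 = trans (inv-cong (char0 0) ι1) inv-1

  exp-zero : expₛ 0 ≈ 1#
  exp-zero = inv-ι1

  D-exp : D expₛ ≐ expₛ
  D-exp = mk ι-suc-inv-suc!

  t⋆expQuot : tₛ ⋆ expQuot ≐ expₛ -ₛ one
  t⋆expQuot = mk coeff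
    where
    coeff : ∀ n → (tₛ ⋆ expQuot) n ≈ (expₛ -ₛ one) n
    coeff zero = trans (t⋆-zero expQuot) (sym (trans (+-congʳ exp-zero) (-‿inverseʳ 1#)))
    coeff (suc n) = trans (t⋆-suc expQuot n) (sym (x-0≈x _))

  t⋆logQuot : tₛ ⋆ logQuot ≐ log1pₛ
  t⋆logQuot = mk λ { zero → t⋆-zero logQuot ; (suc n) → t⋆-suc logQuot n }

  alternating : FPS
  alternating n = (- 1#) ^ n

  D-log1p : D log1pₛ ≐ alternating
  D-log1p = mk λ n → trans (solve 3 (λ a b c → (a :* (b :* c)) := (b :* (a :* c))) refl _ _ _)
                     (trans (*-congˡ (inverseʳ _ (char0 n))) (*-identityʳ _))

  alternating⋆1+t : alternating ⋆ (one +ₛ tₛ) ≐ one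
  alternating⋆1+t = ≐trans (⋆-comm alternating (one +ₛ tₛ)) (≐trans (⋆-distribʳ alternating one tₛ) (mk coeff))
    where
    coeff : ∀ n → ((one ⋆ alternating) +ₛ (tₛ ⋆ alternating)) n ≈ one n
    coeff zero = trans (+-cong (at (⋆-identityˡ alternating) 0) (t⋆-zero alternating)) (+-identityʳ _)
    coeff (suc n) = trans (+-cong (at (⋆-identityˡ alternating) (suc n)) (t⋆-suc alternating n))
      (trans (+-congʳ (-1*x≈-x _)) (-‿inverseˡ _))

  geom⋆1-t : geomₛ ⋆ (one -ₛ tₛ) ≐ one
  geom⋆1-t = ≐trans (⋆-comm geomₛ (one -ₛ tₛ)) (mk coeff)
    where
    tail : ∀ m → Σ≤ m (λ i → (one (suc i) - tₛ (suc i)) * 1#) ≈ - 1#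
    tail zero = trans (*-identityʳ _) (+-identityˡ _)
    tail (suc m) = trans (+-cong (tail m) (trans (*-identityʳ _) (-‿inverseʳ 0#))) (+-identityʳ _)
    coeff : ∀ n → ((one -ₛ tₛ) ⋆ geomₛ) n ≈ one n
    coeff zero = trans (*-identityʳ _) (x-0≈x _)
    coeff (suc n) = trans (Σ-head n _) (trans (+-cong (trans (*-identityʳ _) (x-0≈x _)) (tail n)) (-‿inverseʳ 1#))

  ⋆-comp-t : ∀ f {g} → g 0 ≈ 0# → g ⋆ (f ∘ₛ g) ≐ (tₛ ⋆ f) ∘ₛ g
  ⋆-comp-t f {g} g0 = ≐trans (⋆-congʳ (f ∘ₛ g) (≐sym (comp-t g0))) (≐sym (comp-⋆ tₛ f g0))

  recip-inv : ∀ h → h 0 ≈ 1# → recipₛ h ⋆ h ≐ one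
  recip-inv h h0 =
    recipₛ h ⋆ h                             ≐⟨ ⋆-congˡ (recipₛ h) (≐sym h-as-comp) ⟩
    (geomₛ ∘ₛ g) ⋆ ((one -ₛ tₛ) ∘ₛ g)        ≐⟨ ≐sym (comp-⋆ geomₛ (one -ₛ tₛ) g0) ⟩
    (geomₛ ⋆ (one -ₛ tₛ)) ∘ₛ g               ≐⟨ comp-congˡ g geom⋆1-t ⟩
    one ∘ₛ g                                 ≐⟨ comp-one g ⟩
    one                                      ≐∎
    where
    g : FPS
    g = one -ₛ h
    g0 : g 0 ≈ 0#
    g0 = trans (+-congˡ (-‿cong h0)) (-‿inverseʳ 1#)
    h-as-comp : (one -ₛ tₛ) ∘ₛ g ≐ h
    h-as-comp = ≐trans (comp-− one tₛ g) (mk λ n → begin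
      (one ∘ₛ g) n - (tₛ ∘ₛ g) n     ≈⟨ +-cong (at (comp-one g) n) (-‿cong (at (comp-t g0) n)) ⟩
      one n - (one n - h n)          ≈⟨ +-congˡ (trans (-‿+ _ _) (+-congˡ (-‿involutive _))) ⟩
      one n + (- one n + h n)        ≈⟨ sym (+-assoc _ _ _) ⟩
      (one n - one n) + h n          ≈⟨ +-congʳ (-‿inverseʳ _) ⟩
      0# + h n                       ≈⟨ +-identityˡ _ ⟩
      h n                            ∎)

  comp-recip : ∀ h {g} → h 0 ≈ 1# → g 0 ≈ 0# → (recipₛ h ∘ₛ g) ⋆ (h ∘ₛ g) ≐ one
  comp-recip h {g} h0 g0 =
    ≐trans (≐sym (comp-⋆ (recipₛ h) h g0)) (≐trans (comp-congˡ g (recip-inv h h0)) (comp-one g))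

  D-exp∘ : ∀ {g} → g 0 ≈ 0# → D (expₛ ∘ₛ g) ≐ (expₛ ∘ₛ g) ⋆ D g
  D-exp∘ {g} g0 = ≐trans (chain-rule expₛ g0) (⋆-congʳ (D g) (comp-congˡ g D-exp))

  exp∘-zero : ∀ g → (expₛ ∘ₛ g) 0 ≈ 1#
  exp∘-zero g = trans (comp-zero expₛ g) exp-zero

  -- exp(g)·exp(h) = exp(g + h): both sides solve f' = f·(g + h)'
  exp-add : ∀ {g h} → g 0 ≈ 0# → h 0 ≈ 0# → (expₛ ∘ₛ g) ⋆ (expₛ ∘ₛ h) ≐ expₛ ∘ₛ (g +ₛ h)
  exp-add {g} {h} g0 h0 = ODE-unique (D (g +ₛ h)) D-lhs (D-exp∘ gh0)
    (trans (*-cong (exp∘-zero g) (exp∘-zero h)) (trans (*-identityˡ _) (sym (exp∘-zero (g +ₛ h)))))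
    where
    gh0 : (g +ₛ h) 0 ≈ 0#
    gh0 = trans (+-cong g0 h0) (+-identityˡ 0#)
    Eg Eh : FPS
    Eg = expₛ ∘ₛ g
    Eh = expₛ ∘ₛ h
    D-lhs : D (Eg ⋆ Eh) ≐ (Eg ⋆ Eh) ⋆ D (g +ₛ h)
    D-lhs =
      D (Eg ⋆ Eh)                             ≐⟨ Leibniz Eg Eh ⟩
      (D Eg ⋆ Eh) +ₛ (Eg ⋆ D Eh)              ≐⟨ +ₛ-cong (⋆-congʳ Eh (D-exp∘ g0)) (⋆-congˡ Eg (D-exp∘ h0)) ⟩
      ((Eg ⋆ D g) ⋆ Eh) +ₛ (Eg ⋆ (Eh ⋆ D h))
        ≐⟨ +ₛ-cong (⋆-swapʳ Eg (D g) Eh) (≐sym (⋆-assoc Eg Eh (D h))) ⟩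
      ((Eg ⋆ Eh) ⋆ D g) +ₛ ((Eg ⋆ Eh) ⋆ D h)  ≐⟨ ≐sym (⋆-distribˡ (Eg ⋆ Eh) (D g) (D h)) ⟩
      (Eg ⋆ Eh) ⋆ (D g +ₛ D h)                ≐⟨ ⋆-congˡ (Eg ⋆ Eh) (≐sym (D-+ g h)) ⟩
      (Eg ⋆ Eh) ⋆ D (g +ₛ h)                  ≐∎

  exp∘-vanishing : ∀ {g} → g ≐ 0ₛ → expₛ ∘ₛ g ≐ one
  exp∘-vanishing {g} g≐0 = ODE-unique (D g) (D-exp∘ (at g≐0 0)) D-one′ (exp∘-zero g)
    where
    D-one′ : D one ≐ one ⋆ D g
    D-one′ = mk λ n → trans (zeroʳ _) (sym (trans (at (⋆-identityˡ (D g)) n)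
                                            (trans (*-congˡ (at g≐0 (suc n))) (zeroʳ _))))

  D-log1p∘ : ∀ {g} → g 0 ≈ 0# → D (log1pₛ ∘ₛ g) ⋆ (one +ₛ g) ≐ D g
  D-log1p∘ {g} g0 =
    D (log1pₛ ∘ₛ g) ⋆ (one +ₛ g)
      ≐⟨ ⋆-cong (≐trans (chain-rule log1pₛ g0) (⋆-congʳ (D g) (comp-congˡ g D-log1p))) 1+g-as-comp ⟩
    ((alternating ∘ₛ g) ⋆ D g) ⋆ ((one +ₛ tₛ) ∘ₛ g)
      ≐⟨ ⋆-swapʳ (alternating ∘ₛ g) (D g) ((one +ₛ tₛ) ∘ₛ g) ⟩
    ((alternating ∘ₛ g) ⋆ ((one +ₛ tₛ) ∘ₛ g)) ⋆ D g
      ≐⟨ ⋆-congʳ (D g) (≐trans (≐sym (comp-⋆ alternating (one +ₛ tₛ) g0))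
                                (≐trans (comp-congˡ g alternating⋆1+t) (comp-one g))) ⟩
    one ⋆ D g
      ≐⟨ ⋆-identityˡ (D g) ⟩
    D g ≐∎
    where
    1+g-as-comp : one +ₛ g ≐ (one +ₛ tₛ) ∘ₛ g
    1+g-as-comp = ≐sym (≐trans (comp-+ one tₛ g) (+ₛ-cong (comp-one g) (comp-t g0)))

  exp-neg-log1p : ∀ {g} → g 0 ≈ 0# → (expₛ ∘ₛ scale (- 1#) (log1pₛ ∘ₛ g)) ⋆ (one +ₛ g) ≐ one
  exp-neg-log1p {g} g0 = D-injective constant-term (≐trans derivative-vanishes (≐sym D-one))
    where
    ℓg P : FPS
    ℓg = log1pₛ ∘ₛ g
    P = expₛ ∘ₛ scale (- 1#) ℓg
    -ℓg0 : scale (- 1#) ℓg 0 ≈ 0#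
    -ℓg0 = trans (*-congˡ (comp-zero log1pₛ g)) (zeroʳ _)
    constant-term : (P ⋆ (one +ₛ g)) 0 ≈ one 0
    constant-term = trans (*-cong (exp∘-zero (scale (- 1#) ℓg)) (trans (+-congˡ g0) (+-identityʳ _))) (*-identityˡ _)
    derivative-vanishes : D (P ⋆ (one +ₛ g)) ≐ 0ₛ
    derivative-vanishes =
      D (P ⋆ (one +ₛ g))
        ≐⟨ Leibniz P (one +ₛ g) ⟩
      (D P ⋆ (one +ₛ g)) +ₛ (P ⋆ D (one +ₛ g))
        ≐⟨ +ₛ-cong (⋆-congʳ (one +ₛ g) (≐trans (D-exp∘ -ℓg0) (⋆-congˡ P (D-scale (- 1#) ℓg))))
                   (⋆-congˡ P (≐trans (D-+ one g) (mk λ n → trans (+-congʳ (at D-one n)) (+-identityˡ _)))) ⟩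
      ((P ⋆ scale (- 1#) (D ℓg)) ⋆ (one +ₛ g)) +ₛ (P ⋆ D g)
        ≐⟨ +ₛ-cong (≐trans (⋆-assoc P _ (one +ₛ g))
                     (⋆-congˡ P (≐trans (scale-⋆ˡ (- 1#) (D ℓg) (one +ₛ g)) (scale-cong refl (D-log1p∘ g0)))))
                   ≐refl ⟩
      (P ⋆ scale (- 1#) (D g)) +ₛ (P ⋆ D g)
        ≐⟨ +ₛ-cong (scale-⋆ʳ (- 1#) P (D g)) ≐refl ⟩
      scale (- 1#) (P ⋆ D g) +ₛ (P ⋆ D g)
        ≐⟨ mk (λ n → trans (+-congʳ (-1*x≈-x _)) (-‿inverseˡ _)) ⟩
      0ₛ ≐∎

-- Writing F = log(1+t)^{m+1}, the power
-- rule and (1+t)·log(1+t)' = 1 give (1+t)·F' = (m+1)·log(1+t)^m, i.e.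
-- (j+1) F_{j+1} = (m+1) [t^j] log(1+t)^m - j F_j, which is the recurrence
-- S₁(j+1,m+1) = S₁(j,m) - j S₁(j,m+1) of the Stirling numbers.
module StirlingExpansion {c ℓ} (F : CharZeroField c ℓ) where
  open CharZeroField F hiding (zero)
  open Series F
  open ElementarySeries F public

  S₁-rec : ∀ j m → ιℤ (S₁ (suc j) (suc m)) ≈ ιℤ (S₁ j m) - ι j * ιℤ (S₁ j (suc m))
  S₁-rec j m = trans (ιℤ-− (S₁ j m) (+ j ℤ.* S₁ j (suc m))) (+-congˡ (-‿cong (ιℤ-ℕ* j (S₁ j (suc m)))))

  S₁-zero : ∀ j → ιℤ (S₁ (suc j) 0) ≈ 0#
  S₁-zero j = trans (ιℤ-neg (+ j ℤ.* S₁ j 0)) (trans (-‿cong (ιℤ-ℕ* j (S₁ j 0))) (trans (-‿cong (vanish j)) -0≈0))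
    where
    vanish : ∀ j → ι j * ιℤ (S₁ j 0) ≈ 0#
    vanish zero = zeroˡ _
    vanish (suc j) = trans (*-congˡ (S₁-zero j)) (zeroʳ _)

  logPowCoeff : ℕ → ℕ → Carrier
  logPowCoeff m j = (ι (m !) * ιℤ (S₁ j m)) * (ι (j !)) ⁻¹

  logPowCoeff-rec : ∀ m j →
    ι (suc j) * logPowCoeff (suc m) (suc j) ≈ ι (suc m) * logPowCoeff m j - ι j * logPowCoeff (suc m) j
  logPowCoeff-rec m j = begin
    ι (suc j) * ((ι (suc m !) * ιℤ (S₁ (suc j) (suc m))) * (ι (suc j !)) ⁻¹)
      ≈⟨ solve 3 (λ a b c → (a :* (b :* c)) := (b :* (a :* c))) refl _ _ _ ⟩
    (ι (suc m !) * ιℤ (S₁ (suc j) (suc m))) * (ι (suc j) * (ι (suc j !)) ⁻¹)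
      ≈⟨ *-cong (*-cong (ι-* (suc m) (m !)) (trans (S₁-rec j m) (+-congˡ (sym (-1*x≈-x _))))) (ι-suc-inv-suc! j) ⟩
    ((ι (suc m) * ι (m !)) * (s0 + - 1# * (w * s1))) * v
      ≈⟨ solve 7 (λ a b s0 s1 w mo v →
            (((a :* b) :* (s0 :+ mo :* (w :* s1))) :* v) := ((a :* ((b :* s0) :* v)) :+ mo :* (w :* (((a :* b) :* s1) :* v))))
          refl (ι (suc m)) (ι (m !)) s0 s1 w (- 1#) v ⟩
    ι (suc m) * ((ι (m !) * s0) * v) + - 1# * (w * (((ι (suc m) * ι (m !)) * s1) * v))
      ≈⟨ +-congˡ (trans (-1*x≈-x _) (-‿cong (*-congˡ (*-congʳ (*-congʳ (sym (ι-* (suc m) (m !)))))))) ⟩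
    ι (suc m) * logPowCoeff m j - ι j * logPowCoeff (suc m) j ∎
    where
    s0 s1 w v : Carrier
    s0 = ιℤ (S₁ j m)
    s1 = ιℤ (S₁ j (suc m))
    w = ι j
    v = (ι (j !)) ⁻¹

  log1p-pow : ∀ m j → (log1pₛ ^ₛ m) j ≈ logPowCoeff m j
  log1p-pow zero zero = sym (trans (*-cong (*-cong ι1 ι1) inv-ι1) (trans (*-identityʳ _) (*-identityʳ _)))
  log1p-pow zero (suc j) = sym (trans (*-congʳ (trans (*-congˡ (S₁-zero j)) (zeroʳ _))) (zeroˡ _))
  log1p-pow (suc m) = coeff
    where
    Fs lm : FPS
    Fs = log1pₛ ^ₛ suc m
    lm = log1pₛ ^ₛ m
    D-Fs⋆1+t : D Fs ⋆ (one +ₛ tₛ) ≐ scale (ι (suc m)) lm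
    D-Fs⋆1+t =
      D Fs ⋆ (one +ₛ tₛ)
        ≐⟨ ⋆-congʳ (one +ₛ tₛ) (≐trans (power-rule log1pₛ m) (scale-cong refl (⋆-congˡ lm D-log1p))) ⟩
      scale (ι (suc m)) (lm ⋆ alternating) ⋆ (one +ₛ tₛ)
        ≐⟨ scale-⋆ˡ (ι (suc m)) (lm ⋆ alternating) (one +ₛ tₛ) ⟩
      scale (ι (suc m)) ((lm ⋆ alternating) ⋆ (one +ₛ tₛ))
        ≐⟨ scale-cong refl (≐trans (⋆-assoc lm alternating (one +ₛ tₛ))
                             (≐trans (⋆-congˡ lm alternating⋆1+t) (⋆-identityʳ lm))) ⟩
      scale (ι (suc m)) lm ≐∎
    D-Fs-coeff : ∀ j → D Fs j ≈ ι (suc m) * logPowCoeff m j - ι j * Fs j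
    D-Fs-coeff j = move-right (begin
      D Fs j + ι j * Fs j
        ≈⟨ +-cong (sym (at (⋆-identityʳ (D Fs)) j)) (trans (sym (at (t⋆D Fs) j)) (at (⋆-comm tₛ (D Fs)) j)) ⟩
      (D Fs ⋆ one) j + (D Fs ⋆ tₛ) j   ≈⟨ sym (at (⋆-distribˡ (D Fs) one tₛ) j) ⟩
      (D Fs ⋆ (one +ₛ tₛ)) j           ≈⟨ at D-Fs⋆1+t j ⟩
      ι (suc m) * lm j                 ≈⟨ *-congˡ (log1p-pow m j) ⟩
      ι (suc m) * logPowCoeff m j      ∎)
    coeff : ∀ j → Fs j ≈ logPowCoeff (suc m) j
    coeff zero = trans (zeroˡ _) (sym (trans (*-congʳ (zeroʳ _)) (zeroˡ _)))
    coeff (suc j) = cancelˡ (char0 j) (begin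
      D Fs j                                                     ≈⟨ D-Fs-coeff j ⟩
      ι (suc m) * logPowCoeff m j - ι j * Fs j                   ≈⟨ +-congˡ (-‿cong (*-congˡ (coeff j))) ⟩
      ι (suc m) * logPowCoeff m j - ι j * logPowCoeff (suc m) j  ≈⟨ sym (logPowCoeff-rec m j) ⟩
      ι (suc j) * logPowCoeff (suc m) (suc j)                    ∎)

module GeneratingFunction {c ℓ} (F : CharZeroField c ℓ) (a : CharZeroField.Carrier F)
                          (a≉0 : ¬ (CharZeroField._≈_ F a (CharZeroField.0# F))) where
  open CharZeroField F hiding (zero)
  open Series F
  open StirlingExpansion F public

  u : FPS
  u = scale (a ⁻¹) tₛ
  L : FPS
  L = logA a
  N : FPS
  N = scale (- 1#) L

  -- P y = (1+u)^{-y} = exp(-y L)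
  P : Carrier → FPS
  P y = expₛ ∘ₛ scale (- y) L

  R : FPS
  R = recipₛ expQuot
  K : FPS
  K = recipₛ logQuot

  u0 : u 0 ≈ 0#
  u0 = zeroʳ _

  scaleL0 : ∀ y → scale y L 0 ≈ 0#
  scaleL0 y = trans (*-congˡ (comp-zero log1pₛ u)) (zeroʳ _)

  N0 : N 0 ≈ 0#
  N0 = scaleL0 (- 1#)

  u-cancel : ∀ {f g} → u ⋆ f ≐ u ⋆ g → f ≐ g
  u-cancel {f} {g} p = t-cancel (scale-cancel (inv-≉0 a≉0)
    (≐trans (≐sym (scale-⋆ˡ (a ⁻¹) tₛ f)) (≐trans p (scale-⋆ˡ (a ⁻¹) tₛ g))))

  P-add : ∀ y z → P y ⋆ P z ≐ P (y + z)
  P-add y z = ≐trans (exp-add (scaleL0 (- y)) (scaleL0 (- z)))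
                     (comp-congʳ expₛ (≐trans (scale-+ (- y) (- z) L) (scale-cong (sym (-‿+ y z)) ≐refl)))

  P-pow : ∀ s → P (ι s) ≐ P 1# ^ₛ s
  P-pow zero = exp∘-vanishing (mk λ n → trans (*-congʳ -0≈0) (zeroˡ _))
  P-pow (suc s) = ≐trans (≐sym (P-add 1# (ι s))) (⋆-congˡ (P 1#) (P-pow s))

  -- (1+u)^{-1} (1+u) = 1, hence (1+u)^{-1} - 1 = -u (1+u)^{-1}
  P1-minus-one : P 1# -ₛ one ≐ scale (- 1#) (u ⋆ P 1#)
  P1-minus-one = mk λ n → begin
    P 1# n - one n                         ≈⟨ +-congˡ (-‿cong (sym (at (exp-neg-log1p u0) n))) ⟩
    P 1# n - (P 1# ⋆ (one +ₛ u)) n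
      ≈⟨ +-congˡ (-‿cong (at (≐trans (⋆-distribˡ (P 1#) one u) (+ₛ-cong (⋆-identityʳ (P 1#)) (⋆-comm (P 1#) u))) n)) ⟩
    P 1# n - (P 1# n + (u ⋆ P 1#) n)       ≈⟨ +-congˡ (-‿+ _ _) ⟩
    P 1# n + (- P 1# n + - (u ⋆ P 1#) n)   ≈⟨ sym (+-assoc _ _ _) ⟩
    (P 1# n - P 1# n) + - (u ⋆ P 1#) n     ≈⟨ +-congʳ (-‿inverseʳ _) ⟩
    0# + - (u ⋆ P 1#) n                    ≈⟨ +-identityˡ _ ⟩
    - (u ⋆ P 1#) n                         ≈⟨ sym (-1*x≈-x _) ⟩
    - 1# * (u ⋆ P 1#) n                    ∎

  exp-scaled∘N : ∀ x → (expₛ ∘ₛ scale x tₛ) ∘ₛ N ≐ P x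
  exp-scaled∘N x = mk λ n → Σ-cong′ n (λ j → begin
    (expₛ ∘ₛ scale x tₛ) j * (N ^ₛ j) n
      ≈⟨ *-cong (comp-dilation expₛ x j) (at (^ₛ-scale (- 1#) L j) n) ⟩
    (x ^ j * expₛ j) * ((- 1#) ^ j * (L ^ₛ j) n)
      ≈⟨ solve 4 (λ p e m l → ((p :* e) :* (m :* l)) := (e :* ((m :* p) :* l))) refl (x ^ j) (expₛ j) ((- 1#) ^ j) ((L ^ₛ j) n) ⟩
    expₛ j * (((- 1#) ^ j * x ^ j) * (L ^ₛ j) n)
      ≈⟨ *-congˡ (*-congʳ (trans (sym (pow-* (- 1#) x j)) (pow-cong j (-1*x≈-x x)))) ⟩
    expₛ j * ((- x) ^ j * (L ^ₛ j) n)
      ≈⟨ *-congˡ (sym (at (^ₛ-scale (- x) L j) n)) ⟩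
    expₛ j * (scale (- x) L ^ₛ j) n ∎)

  quotients-product : (expQuot ∘ₛ N) ⋆ (logQuot ∘ₛ u) ≐ P 1#
  quotients-product = u-cancel (
    u ⋆ (A ⋆ B)      ≐⟨ ⋆-rotate u A B ⟩
    (u ⋆ B) ⋆ A      ≐⟨ ⋆-congʳ A (≐trans (⋆-comp-t logQuot u0) (comp-congˡ u t⋆logQuot)) ⟩
    L ⋆ A            ≐⟨ scale-cancel -1#≉0 N⋆A≐-u⋆P1 ⟩
    u ⋆ P 1#         ≐∎)
    where
    A B : FPS
    A = expQuot ∘ₛ N
    B = logQuot ∘ₛ u
    N⋆A≐-u⋆P1 : scale (- 1#) (L ⋆ A) ≐ scale (- 1#) (u ⋆ P 1#)
    N⋆A≐-u⋆P1 =
      scale (- 1#) (L ⋆ A)   ≐⟨ ≐sym (scale-⋆ˡ (- 1#) L A) ⟩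
      N ⋆ A                  ≐⟨ ⋆-comp-t expQuot N0 ⟩
      (tₛ ⋆ expQuot) ∘ₛ N    ≐⟨ ≐trans (comp-congˡ N t⋆expQuot) (comp-− expₛ one N) ⟩
      P 1# -ₛ (one ∘ₛ N)     ≐⟨ mk (λ n → +-congˡ (-‿cong (at (comp-one N) n))) ⟩
      P 1# -ₛ one            ≐⟨ P1-minus-one ⟩
      scale (- 1#) (u ⋆ P 1#) ≐∎

  kernel-product : ((R ∘ₛ N) ⋆ (K ∘ₛ u)) ⋆ P 1# ≐ one
  kernel-product =
    ((R ∘ₛ N) ⋆ (K ∘ₛ u)) ⋆ P 1#
      ≐⟨ ⋆-congˡ ((R ∘ₛ N) ⋆ (K ∘ₛ u)) (≐sym quotients-product) ⟩
    ((R ∘ₛ N) ⋆ (K ∘ₛ u)) ⋆ ((expQuot ∘ₛ N) ⋆ (logQuot ∘ₛ u))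
      ≐⟨ ⋆-interchange (R ∘ₛ N) (K ∘ₛ u) (expQuot ∘ₛ N) (logQuot ∘ₛ u) ⟩
    ((R ∘ₛ N) ⋆ (expQuot ∘ₛ N)) ⋆ ((K ∘ₛ u) ⋆ (logQuot ∘ₛ u))
      ≐⟨ ⋆-cong (comp-recip expQuot inv-ι1 N0) (comp-recip logQuot (trans (*-identityˡ _) inv-ι1) u0) ⟩
    one ⋆ one
      ≐⟨ ⋆-identityˡ one ⟩
    one ≐∎

  module Expansion (k : ℤ) (s : ℕ) (x : Carrier) where
    G : Carrier → FPS
    G y = PCgen k y a

    β : FPS
    β = (R ^ₛ s) ⋆ (expₛ ∘ₛ scale x tₛ)

    H : FPS
    H = ((K ^ₛ s) ∘ₛ u) ⋆ G (ι s)

    generating-identity : G x ≐ (β ∘ₛ N) ⋆ H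
    generating-identity = ≐sym (
      (β ∘ₛ N) ⋆ H
        ≐⟨ ⋆-cong (≐trans (comp-⋆ (R ^ₛ s) _ N0) (⋆-cong (comp-^ R N0 s) (exp-scaled∘N x)))
                  (⋆-cong (comp-^ K u0 s) (⋆-congˡ E (⋆-congˡ Λ (P-pow s)))) ⟩
      (((R ∘ₛ N) ^ₛ s) ⋆ P x) ⋆ (((K ∘ₛ u) ^ₛ s) ⋆ (E ⋆ (Λ ⋆ (P 1# ^ₛ s))))
        ≐⟨ ⋆-Solver.solve 6 (λ r px kk e l p → ((r ⊕ px) ⊕ (kk ⊕ (e ⊕ (l ⊕ p)))) ⊜ ((e ⊕ (l ⊕ px)) ⊕ ((r ⊕ kk) ⊕ p)))
              ≐refl ((R ∘ₛ N) ^ₛ s) (P x) ((K ∘ₛ u) ^ₛ s) E Λ (P 1# ^ₛ s) ⟩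
      G x ⋆ ((((R ∘ₛ N) ^ₛ s) ⋆ ((K ∘ₛ u) ^ₛ s)) ⋆ (P 1# ^ₛ s))
        ≐⟨ ⋆-congˡ (G x) (≐trans (⋆-congʳ (P 1# ^ₛ s) (≐sym (^ₛ-⋆ (R ∘ₛ N) (K ∘ₛ u) s)))
                            (≐trans (≐sym (^ₛ-⋆ ((R ∘ₛ N) ⋆ (K ∘ₛ u)) (P 1#) s))
                              (≐trans (^ₛ-cong s kernel-product) (^ₛ-one s)))) ⟩
      G x ⋆ one
        ≐⟨ ⋆-identityʳ (G x) ⟩
      G x ≐∎)
      where
      open ⋆-Solver using (_⊜_; _⊕_)
      E Λ : FPS
      E = expₛ ∘ₛ scale (- 1#) tₛ
      Λ = Lifₛ k ∘ₛ L

module CoefficientComparison {c ℓ} (F : CharZeroField c ℓ) (a : CharZeroField.Carrier F)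
                             (a≉0 : ¬ (CharZeroField._≈_ F a (CharZeroField.0# F)))
                             (k : ℤ) (s : ℕ) (x : CharZeroField.Carrier F) where
  open CharZeroField F hiding (zero)
  open Series F
  open GeneratingFunction F a a≉0 public
  open Expansion k s x public

  binomial-factorialsF : ∀ {n k} → k ℕ.≤ n → ι (n C k) * (ι (k !) * ι ((n ∸ k) !)) ≈ ι (n !)
  binomial-factorialsF {n} {k} le =
    trans (*-congˡ (sym (ι-* (k !) ((n ∸ k) !))))
          (trans (sym (ι-* (n C k) _)) (reflexive (P.cong ι (binomial-factorials le))))

  trinomial-factorials : ∀ {n l i} → l ℕ.≤ n → i ℕ.≤ l →
    (ι (n C l) * ι (l C i)) * (ι (i !) * ι ((l ∸ i) !)) ≈ ι (n !) * (ι ((n ∸ l) !)) ⁻¹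
  trinomial-factorials {n} {l} {i} l≤n i≤l = begin
    (ι (n C l) * ι (l C i)) * (ι (i !) * ι ((l ∸ i) !))   ≈⟨ *-assoc _ _ _ ⟩
    ι (n C l) * (ι (l C i) * (ι (i !) * ι ((l ∸ i) !)))   ≈⟨ *-congˡ (binomial-factorialsF i≤l) ⟩
    ι (n C l) * ι (l !)                                   ≈⟨ sym (*-identityʳ _) ⟩
    ι (n C l) * ι (l !) * 1#                              ≈⟨ *-congˡ (sym (inverseʳ _ (ι!≉0 (n ∸ l)))) ⟩
    ι (n C l) * ι (l !) * (ι ((n ∸ l) !) * (ι ((n ∸ l) !)) ⁻¹)
      ≈⟨ solve 4 (λ a b c d → ((a :* b) :* (c :* d)) := ((a :* (b :* c)) :* d)) refl _ _ _ _ ⟩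
    ι (n C l) * (ι (l !) * ι ((n ∸ l) !)) * (ι ((n ∸ l) !)) ⁻¹  ≈⟨ *-congʳ (binomial-factorialsF l≤n) ⟩
    ι (n !) * (ι ((n ∸ l) !)) ⁻¹                                ∎

  L-pow-coeff : ∀ m j → (L ^ₛ m) j ≈ (a ⁻¹) ^ j * logPowCoeff m j
  L-pow-coeff m j = trans (sym (at (comp-^ log1pₛ u0 m) j))
                          (trans (comp-dilation (log1pₛ ^ₛ m) (a ⁻¹) j) (*-congˡ (log1p-pow m j)))

  T : ℕ → ℕ → ℕ → ℕ → Carrier
  T n m l i = ((((ι (n C l) * ι (l C i)) * ((a ^ ((n ∸ l) ℕ.+ i)) ⁻¹))
              * ιℤ (S₁ (n ∸ l) m)) * Cauchy s i) * PC (l ∸ i) k (ι s) a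

  summand : ∀ n m l i → l ℕ.≤ n → i ℕ.≤ l →
    ι (m !) * T n m l i ≈ ι (n !) * ((((K ^ₛ s) ∘ₛ u) i * G (ι s) (l ∸ i)) * (L ^ₛ m) (n ∸ l))
  summand n m l i l≤n i≤l = begin
    fm * (((((Bn * Bl) * (a ^ ((n ∸ l) ℕ.+ i)) ⁻¹) * S) * (fi * kᵢ)) * (fli * gs))
      ≈⟨ *-congˡ (*-congʳ (*-congʳ (*-congʳ (*-congˡ (trans (inv-pow ((n ∸ l) ℕ.+ i) a≉0) (pow-+ (a ⁻¹) (n ∸ l) i)))))) ⟩
    fm * (((((Bn * Bl) * (A1 * A2)) * S) * (fi * kᵢ)) * (fli * gs))
      ≈⟨ solve 10 (λ fm Bn Bl A1 A2 S fi kᵢ fli gs →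
            (fm :* (((((Bn :* Bl) :* (A1 :* A2)) :* S) :* (fi :* kᵢ)) :* (fli :* gs)))
            := (((Bn :* Bl) :* (fi :* fli)) :* (fm :* (A1 :* (A2 :* (S :* (kᵢ :* gs)))))))
          refl fm Bn Bl A1 A2 S fi kᵢ fli gs ⟩
    ((Bn * Bl) * (fi * fli)) * (fm * (A1 * (A2 * (S * (kᵢ * gs)))))
      ≈⟨ *-congʳ (trinomial-factorials l≤n i≤l) ⟩
    (fn * fnl⁻¹) * (fm * (A1 * (A2 * (S * (kᵢ * gs)))))
      ≈⟨ solve 8 (λ fn fnl⁻¹ fm A1 A2 S kᵢ gs →
            ((fn :* fnl⁻¹) :* (fm :* (A1 :* (A2 :* (S :* (kᵢ :* gs))))))
            := (fn :* (((A2 :* kᵢ) :* gs) :* (A1 :* ((fm :* S) :* fnl⁻¹)))))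
          refl fn fnl⁻¹ fm A1 A2 S kᵢ gs ⟩
    fn * (((A2 * kᵢ) * gs) * (A1 * ((fm * S) * fnl⁻¹)))
      ≈⟨ *-congˡ (*-cong (*-congʳ (sym (comp-dilation (K ^ₛ s) (a ⁻¹) i))) (sym (L-pow-coeff m (n ∸ l)))) ⟩
    fn * ((((K ^ₛ s) ∘ₛ u) i * G (ι s) (l ∸ i)) * (L ^ₛ m) (n ∸ l)) ∎
    where
    fm fn Bn Bl A1 A2 S fi kᵢ fli gs fnl⁻¹ : Carrier
    fm = ι (m !)
    fn = ι (n !)
    Bn = ι (n C l)
    Bl = ι (l C i)
    A1 = (a ⁻¹) ^ (n ∸ l)
    A2 = (a ⁻¹) ^ i
    S = ιℤ (S₁ (n ∸ l) m)
    fi = ι (i !)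
    kᵢ = (K ^ₛ s) i
    fli = ι ((l ∸ i) !)
    gs = G (ι s) (l ∸ i)
    fnl⁻¹ = (ι ((n ∸ l) !)) ⁻¹

  double-sum : ∀ n m → m ℕ.≤ n →
    ι (m !) * Σ≤ (n ∸ m) (λ l → Σ≤ l (T n m l)) ≈ ι (n !) * ((L ^ₛ m) ⋆ H) n
  double-sum n m m≤n = begin
    ι (m !) * Σ≤ (n ∸ m) (λ l → Σ≤ l (T n m l))
      ≈⟨ Σ-*ˡ (n ∸ m) _ _ ⟩
    Σ≤ (n ∸ m) (λ l → ι (m !) * Σ≤ l (T n m l))
      ≈⟨ Σ-cong (n ∸ m) (λ l le → inner l (NP.≤-trans le (NP.m∸n≤m n m))) ⟩
    Σ≤ (n ∸ m) (λ l → ι (n !) * (H l * (L ^ₛ m) (n ∸ l)))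
      ≈⟨ sym (Σ-*ˡ (n ∸ m) _ _) ⟩
    ι (n !) * Σ≤ (n ∸ m) (λ l → H l * (L ^ₛ m) (n ∸ l))
      ≈⟨ *-congˡ (sym (Σ-truncate (n ∸ m) n _ (NP.m∸n≤m n m) high-terms-vanish)) ⟩
    ι (n !) * (H ⋆ (L ^ₛ m)) n
      ≈⟨ *-congˡ (at (⋆-comm H (L ^ₛ m)) n) ⟩
    ι (n !) * ((L ^ₛ m) ⋆ H) n ∎
    where
    inner : ∀ l → l ℕ.≤ n → ι (m !) * Σ≤ l (T n m l) ≈ ι (n !) * (H l * (L ^ₛ m) (n ∸ l))
    inner l l≤n = begin
      ι (m !) * Σ≤ l (T n m l)                   ≈⟨ Σ-*ˡ l _ _ ⟩
      Σ≤ l (λ i → ι (m !) * T n m l i)           ≈⟨ Σ-cong l (λ i i≤l → summand n m l i l≤n i≤l) ⟩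
      Σ≤ l (λ i → ι (n !) * (_ * (L ^ₛ m) (n ∸ l)))  ≈⟨ sym (Σ-*ˡ l _ _) ⟩
      ι (n !) * Σ≤ l (λ i → _ * (L ^ₛ m) (n ∸ l))    ≈⟨ *-congˡ (sym (Σ-*ʳ l _ _)) ⟩
      ι (n !) * (H l * (L ^ₛ m) (n ∸ l))         ∎
    -- L^m starts at degree m
    high-terms-vanish : ∀ l → n ∸ m ℕ.< l → l ℕ.≤ n → H l * (L ^ₛ m) (n ∸ l) ≈ 0#
    high-terms-vanish l lt l≤n =
      trans (*-congˡ (pow-vanishes (comp-zero log1pₛ u) m (n ∸ l) (∸-swap-< n m l l≤n lt))) (zeroʳ _)

  coefficient-m : ∀ n m → m ℕ.≤ n →
    ι (n !) * (β m * ((N ^ₛ m) ⋆ H) n) ≈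
    ((- 1#) ^ m * Σ≤ (n ∸ m) (λ l → Σ≤ l (T n m l))) * Bernoulli s m x
  coefficient-m n m m≤n = begin
    ι (n !) * (β m * ((N ^ₛ m) ⋆ H) n)
      ≈⟨ *-congˡ (*-congˡ (trans (at (⋆-congʳ H (^ₛ-scale (- 1#) L m)) n) (at (scale-⋆ˡ ((- 1#) ^ m) (L ^ₛ m) H) n))) ⟩
    ι (n !) * (β m * ((- 1#) ^ m * ((L ^ₛ m) ⋆ H) n))
      ≈⟨ solve 4 (λ fn b e y → (fn :* (b :* (e :* y))) := ((e :* b) :* (fn :* y))) refl _ _ _ _ ⟩
    ((- 1#) ^ m * β m) * (ι (n !) * ((L ^ₛ m) ⋆ H) n)
      ≈⟨ *-congˡ (sym (double-sum n m m≤n)) ⟩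
    ((- 1#) ^ m * β m) * (ι (m !) * ΣT)
      ≈⟨ solve 4 (λ e b fm y → ((e :* b) :* (fm :* y)) := ((e :* y) :* (fm :* b))) refl _ _ _ _ ⟩
    ((- 1#) ^ m * ΣT) * (ι (m !) * β m) ∎
    where
    ΣT : Carrier
    ΣT = Σ≤ (n ∸ m) (λ l → Σ≤ l (T n m l))


theorem8 : ∀ {c ℓ} (F : CharZeroField c ℓ) → let open CharZeroField F in let open Series F in
    ∀ (n : ℕ) (k : ℤ) (s : ℕ) (a : Carrier) → ¬ (a ≈ 0#) → ∀ (x : Carrier) →
      PC n k x a ≈
        Σ≤ n (λ m →
          ((((- 1#) ^ m) *
            Σ≤ (n ∸ m) (λ l → Σ≤ l (λ i →
              ((((ι (n C l) * ι (l C i)) * ((a ^ ((n ∸ l) ℕ.+ i)) ⁻¹))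
                * ιℤ (S₁ (n ∸ l) m)) * Cauchy s i) * PC (l ∸ i) k (ι s) a)))
          * Bernoulli s m x))
theorem8 F n k s a a≉0 x = begin
  ι (n !) * G x n                                     ≈⟨ *-congˡ (at generating-identity n) ⟩
  ι (n !) * ((β ∘ₛ N) ⋆ H) n                          ≈⟨ *-congˡ (comp-⋆-coeff β H N0 n) ⟩
  ι (n !) * Σ≤ n (λ m → β m * ((N ^ₛ m) ⋆ H) n)       ≈⟨ Σ-*ˡ n _ _ ⟩
  Σ≤ n (λ m → ι (n !) * (β m * ((N ^ₛ m) ⋆ H) n))     ≈⟨ Σ-cong n (coefficient-m n) ⟩
  Σ≤ n (λ m → ((- 1#) ^ m * Σ≤ (n ∸ m) (λ l → Σ≤ l (T n m l))) * Bernoulli s m x) ∎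
  where
  open CharZeroField F hiding (zero)
  open Series F
  open CoefficientComparison F a a≉0 k s x
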